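{- For each integer $k\ge1$, \[ \operatorname{Ch}_{k}\big((-1)\times q\big)= -\,q(q+1)\cdots(q+k-1), \qquad \operatorname{Ch}_{k}\big(p\times(-1)\big)=(-1)^k\,p(p+1)\cdots(p+k-1), \] as polynomial identities in $q$ and $p$ respectively.
   Context: For a partition $\pi$ of $k$ and a partition $\lambda$ of $n$, $\operatorname{Ch}_\pi(\lambda)= n^{\downarrow k}\, \chi^\lambda_{\pi\cup(1^{n-k})}/f^\lambda$ if $n\ge k$ and $0$ otherwise ($\chi^\lambda_\mu$ the irreducible character of $\mathfrak{S}_n$ at cycle type $\mu$, $f^\lambda$ its dimension, $n^{\downarrow k}=n(n-1)\cdots(n-k+1)$); $\operatorname{Ch}_k:=\operatorname{Ch}_{(k)}$. $p\times q$ is the rectangular Young diagram with $p$ rows of length $q$. For fixed $\pi$ there is a unique polynomial in $\mathbb{Q}[p,q]$ agreeing with $\operatorname{Ch}_\pi(p\times q)$ at all positive integers $p,q$ (namely $(-1)^k\sum_{\sigma_1\sigma_2=w_\pi}(-q)^{\kappa(\sigma_1)}p^{\kappa(\sigma_2)}$ over $\sigma_1,\sigma_2\in\mathfrak{S}_k$, $w_\pi$ a fixed permutation of cycle type $\pi$, $\kappa$ = number of cycles); for arbitrary complex $p,q$ (e.g. $p=-1$), $\operatorname{Ch}_\pi(p\times q)$ means the value of this polynomial. -}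

module Defs where

open import Data.Nat as ℕ using (ℕ; zero; suc)
open import Data.Nat.DivMod using (_mod_)
open import Data.Bool using (Bool; true; false; if_then_else_; _∧_)
open import Data.Fin as Fin using (Fin; toℕ)
open import Data.Fin.Properties using () renaming (_≟_ to _≟F_)
open import Data.Vec as Vec using (Vec; []; _∷_; lookup; tabulate)
open import Data.Vec.Properties using (≡-dec)
open import Data.List as List using (List; []; _∷_; _++_; concatMap; map; filterᵇ; length; allFin; upTo)
open import Data.Bool.ListAction using (and)
open import Data.Integer as ℤ using (ℤ; +_; -_; _*_; _^_)
open import Relation.Nullary.Decidable using (⌊_⌋; does)

-- Permutations of {0,…,k-1} are represented by their value tables:
-- σ is the vector (σ(0), …, σ(k-1)).
Perm : ℕ → Set
Perm k = Vec (Fin k) k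

allVecs : (m n : ℕ) → List (Vec (Fin n) m)
allVecs zero    n = Vec.[] ∷ []
allVecs (suc m) n = concatMap (λ i → map (i Vec.∷_) (allVecs m n)) (allFin n)

isInjective : ∀ {k} → Perm k → Bool
isInjective {k} σ =
  and (map (λ i → and (map (λ j →
        does (i ≟F j) ∨' (if does (lookup σ i ≟F lookup σ j) then false else true))
      (allFin k))) (allFin k))
  where
    _∨'_ : Bool → Bool → Bool
    true ∨' _ = true
    false ∨' b = b

perms : (k : ℕ) → List (Perm k)
perms k = filterᵇ isInjective (allVecs k k)

_∘ₚ_ : ∀ {k} → Perm k → Perm k → Perm k
σ₁ ∘ₚ σ₂ = tabulate (λ i → lookup σ₁ (lookup σ₂ i))

iter : ∀ {k} → Perm k → ℕ → Fin k → Fin k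
iter σ zero    i = i
iter σ (suc j) i = lookup σ (iter σ j i)

-- i is the smallest element of its σ-orbit (orbits have size ≤ k)
isCycleMin : ∀ {k} → Perm k → Fin k → Bool
isCycleMin {k} σ i = and (map (λ j → toℕ i ℕ.≤ᵇ toℕ (iter σ j i)) (upTo k))

-- κ(σ) : number of cycles of σ (each cycle counted via its minimum)
κ : ∀ {k} → Perm k → ℕ
κ {k} σ = length (filterᵇ (isCycleMin σ) (allFin k))

-- the fixed full cycle w_(k) = (0 1 … k-1), i ↦ i+1 mod k, of cycle type (k)
fullCycle : (k : ℕ) → Perm k
fullCycle zero    = []
fullCycle (suc n) = tabulate (λ i → suc (toℕ i) mod (suc n))

sumℤ : List ℤ → ℤ
sumℤ = List.foldr ℤ._+_ (+ 0)

-- Ch_k(p × q) as the polynomial (in p, q) from the context: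
--   (-1)^k Σ_{σ₁ σ₂ = w_(k)} (-q)^{κ(σ₁)} p^{κ(σ₂)},  σ₁, σ₂ ∈ S_k,
-- evaluated at integers p, q.
Ch : ℕ → ℤ → ℤ → ℤ
Ch k p q =
  ((- + 1) ^ k) *
  sumℤ (concatMap (λ σ₁ → map (λ σ₂ →
          if ⌊ ≡-dec _≟F_ (σ₁ ∘ₚ σ₂) (fullCycle k) ⌋
          then ((- q) ^ κ σ₁) * (p ^ κ σ₂)
          else + 0)
        (perms k)) (perms k))

rising : ℤ → ℕ → ℤ
rising x zero    = + 1
rising x (suc k) = rising x k * (x ℤ.+ + k)

-- With w the long cycle, Ch_k(p × q) = (-1)^k Σ_{σ₁ σ₂ = w} (-q)^{κ σ₁} p^{κ σ₂}, and in a
-- factorisation σ₁ σ₂ = w either factor determines the other. At q = -1 the weight of σ₁ is 1,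
-- leaving (-1)^k Σ_{σ ∈ S_k} p^{κ σ}; this sum is p (p + 1) ⋯ (p + k - 1), because inserting the
-- point k into a permutation of the other points either makes it a new fixed point (weight p) or
-- puts it into a cycle just before one of the k - 1 others. At p = -1 the weight (-1)^{κ σ₂} is
-- fixed by σ₁ through the sign (-1)^{k - κ σ}: the sign is multiplicative and w has one cycle, so
-- (-1)^{κ σ₂} = (-1)^{k + 1 + κ σ₁}, and the sum reduces to the previous one. Multiplicativity of
-- the sign is proved by induction on k, comparing σ, τ and σ τ with the permutations obtained by
-- cutting the last point out of their cycles.

module Submission where

open import Defs
open import Level using (Level)
open import Function using (_∘_; id)
open import Function.Definitions using (Injective)
open import Data.Bool using (Bool; true; false; if_then_else_; T)
open import Data.Empty using (⊥-elim)
open import Data.Unit using (tt)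
open import Data.Product using (_×_; _,_; ∃; proj₁; proj₂; uncurry)
open import Data.Sum using (_⊎_; inj₁; inj₂; [_,_])
open import Data.Nat as ℕ using (ℕ; zero; suc; _≤_; _<_; _∸_; _%_; _/_)
import Data.Nat.Properties as ℕ
open import Data.Nat.DivMod
  using (_mod_; m≡m%n+[m/n]*n; m%n<n; m<n⇒m%n≡m; [m+n]%n≡m%n; %-distribˡ-+; m%n%n≡m%n; n%n≡0)
open import Data.Nat.Properties
  using (n<1+n; ≤-antisym; ≤-trans; ≤-reflexive; ≤-pred; <⇒≤; <-≤-trans; ≤ᵇ⇒≤; ≤⇒≤ᵇ; m<n⇒0<n∸m; m∸n≤m; m+[n∸m]≡n)
open import Data.Integer as ℤ using (ℤ; +_; -_; _+_; _*_; _^_; 0ℤ; 1ℤ; -1ℤ)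
open import Data.Integer.Tactic.RingSolver using (solve-∀)
open import Data.Integer.Properties
  using (+-identityˡ; +-identityʳ; +-assoc; +-comm; *-comm; *-assoc; *-identityˡ; *-identityʳ; *-zeroʳ; *-distribˡ-+;
         ^-distribˡ-+-*; ^-identityʳ; ^-zeroˡ)
open import Data.Fin as Fin using (Fin; toℕ; fromℕ; inject₁)
open import Data.Fin.Relation.Unary.Top using (view; ‵fromℕ; ‵inject₁; view-fromℕ; view-inject₁)
open import Data.Fin.Properties
  using (any?; pigeonhole; punchOut-injective; <⇒≢; fromℕ≢inject₁; inject₁-injective; toℕ<n; toℕ-fromℕ; toℕ-inject₁;
         toℕ-injective; toℕ-fromℕ<)
  renaming (_≟_ to _≟F_)
open import Data.Vec as Vec using (Vec; []; _∷_; lookup; tabulate)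
open import Data.Vec.Properties using (lookup∘tabulate; tabulate∘lookup; tabulate-cong; ≡-dec)
open import Data.List as List using (List; []; _∷_; _++_; map; concatMap; allFin; upTo; length; filterᵇ; cartesianProduct)
open import Data.List.Properties using (map-++; length-tabulate; filter-none)
open import Data.List.Membership.Propositional using (_∈_)
open import Data.List.Membership.Propositional.Properties
  using (∈-map⁺; ∈-map⁻; ∈-concatMap⁺; ∈-filter⁺; ∈-filter⁻; ∈-allFin; ∈-upTo⁺; ∈-tabulate⁻; ∈-cartesianProduct⁺;
         ∈-cartesianProduct⁻)
open import Data.List.Relation.Unary.Any as Any using (here; there; satisfied)
open import Data.List.Relation.Unary.All as All using (All)
open import Data.List.Relation.Unary.All.Properties using (all⁺; all⁻; ¬All⇒Any¬)
open import Data.List.Relation.Unary.AllPairs as AllPairs using (_∷_)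
import Data.List.Relation.Unary.AllPairs.Properties as AllPairs
open import Data.List.Relation.Unary.Unique.Propositional using (Unique)
import Data.List.Relation.Unary.Unique.Propositional.Properties as Unique
open import Relation.Nullary using (¬_; Dec; yes; no)
open import Relation.Nullary.Decidable using (⌊_⌋; T?; fromWitness; toWitness)
open import Relation.Binary.Definitions using (DecidableEquality)
open import Relation.Binary.PropositionalEquality hiding ([_])
open ≡-Reasoning

private variable
  ℓ ℓ′ : Level
  A : Set ℓ
  B : Set ℓ′
  k : ℕ

-- Finite sums over lists

∑ : List A → (A → ℤ) → ℤ
∑ xs f = sumℤ (map f xs)

infix 5 ∑
syntax ∑ xs (λ x → e) = ∑[ x ∈ xs ] e

∑-cong : ∀ (xs : List A) {f g : A → ℤ} → (∀ {x} → x ∈ xs → f x ≡ g x) → ∑ xs f ≡ ∑ xs g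
∑-cong []       f≡g = refl
∑-cong (x ∷ xs) f≡g = cong₂ _+_ (f≡g (here refl)) (∑-cong xs (f≡g ∘ there))

sumℤ-++ : ∀ xs ys → sumℤ (xs ++ ys) ≡ sumℤ xs + sumℤ ys
sumℤ-++ []       ys = sym (+-identityˡ _)
sumℤ-++ (x ∷ xs) ys = trans (cong (_+_ x) (sumℤ-++ xs ys)) (sym (+-assoc x _ _))

sumℤ-concatMap : ∀ (h : A → List ℤ) xs → sumℤ (concatMap h xs) ≡ ∑[ x ∈ xs ] sumℤ (h x)
sumℤ-concatMap h []       = refl
sumℤ-concatMap h (x ∷ xs) = trans (sumℤ-++ (h x) _) (cong (_+_ (sumℤ (h x))) (sumℤ-concatMap h xs))

∑-map : ∀ (g : A → B) xs (f : B → ℤ) → ∑ (map g xs) f ≡ ∑[ x ∈ xs ] f (g x)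
∑-map g []       f = refl
∑-map g (x ∷ xs) f = cong (_+_ (f (g x))) (∑-map g xs f)

∑-cartesianProduct : ∀ (xs : List A) (ys : List B) (f : A × B → ℤ) →
                     ∑ (cartesianProduct xs ys) f ≡ ∑[ x ∈ xs ] ∑[ y ∈ ys ] f (x , y)
∑-cartesianProduct []       ys f = refl
∑-cartesianProduct (x ∷ xs) ys f = begin
  sumℤ (map f (map (x ,_) ys ++ cartesianProduct xs ys))
    ≡⟨ cong sumℤ (map-++ f (map (x ,_) ys) _) ⟩
  sumℤ (map f (map (x ,_) ys) ++ map f (cartesianProduct xs ys))
    ≡⟨ sumℤ-++ (map f (map (x ,_) ys)) _ ⟩
  ∑ (map (x ,_) ys) f + ∑ (cartesianProduct xs ys) f
    ≡⟨ cong₂ _+_ (∑-map (x ,_) ys f) (∑-cartesianProduct xs ys f) ⟩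
  (∑[ y ∈ ys ] f (x , y)) + (∑[ x′ ∈ xs ] ∑[ y ∈ ys ] f (x′ , y)) ∎

∑-zero : ∀ (xs : List A) → ∑[ x ∈ xs ] 0ℤ ≡ 0ℤ
∑-zero []       = refl
∑-zero (x ∷ xs) = trans (+-identityˡ _) (∑-zero xs)

∑-distrib-+ : ∀ (xs : List A) (f g : A → ℤ) → ∑[ x ∈ xs ] (f x + g x) ≡ ∑ xs f + ∑ xs g
∑-distrib-+ []       f g = refl
∑-distrib-+ (x ∷ xs) f g = begin
  f x + g x + (∑[ x′ ∈ xs ] (f x′ + g x′)) ≡⟨ cong (_+_ (f x + g x)) (∑-distrib-+ xs f g) ⟩
  f x + g x + (∑ xs f + ∑ xs g)          ≡⟨ interchange (f x) (g x) _ _ ⟩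
  f x + ∑ xs f + (g x + ∑ xs g)          ∎
  where
  interchange : ∀ p q r s → p + q + (r + s) ≡ p + r + (q + s)
  interchange = solve-∀

∑-*ˡ : ∀ (xs : List A) (c : ℤ) (f : A → ℤ) → ∑[ x ∈ xs ] (c * f x) ≡ c * ∑ xs f
∑-*ˡ []       c f = sym (*-zeroʳ c)
∑-*ˡ (x ∷ xs) c f = trans (cong (_+_ (c * f x)) (∑-*ˡ xs c f)) (sym (*-distribˡ-+ c (f x) _))

∑-comm : ∀ (xs : List A) (ys : List B) (f : A → B → ℤ) →
         ∑[ x ∈ xs ] ∑[ y ∈ ys ] f x y ≡ ∑[ y ∈ ys ] ∑[ x ∈ xs ] f x y
∑-comm []       ys f = sym (∑-zero ys)
∑-comm (x ∷ xs) ys f =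
  trans (cong (_+_ (∑ ys (f x))) (∑-comm xs ys f)) (sym (∑-distrib-+ ys (f x) _))

∑-if-none : ∀ {xs : List A} (p : A → Bool) (f : A → ℤ) → (∀ {x} → x ∈ xs → ¬ T (p x)) →
            ∑[ x ∈ xs ] (if p x then f x else 0ℤ) ≡ 0ℤ
∑-if-none {xs = []}     p f none = refl
∑-if-none {xs = x ∷ xs} p f none with p x | none (here refl)
... | true  | ¬px = ⊥-elim (¬px tt)
... | false | _   = trans (+-identityˡ _) (∑-if-none p f (none ∘ there))

∑-if-unique : ∀ {xs : List A} (p : A → Bool) (f : A → ℤ) {x₀} → Unique xs → x₀ ∈ xs → T (p x₀) →
              (∀ {x} → x ∈ xs → T (p x) → x ≡ x₀) →
              ∑[ x ∈ xs ] (if p x then f x else 0ℤ) ≡ f x₀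
∑-if-unique {xs = x ∷ xs} p f (x∉xs ∷ _) (here refl) px only with p x | px
... | true | _ = trans (cong (_+_ (f x)) (∑-if-none p f others)) (+-identityʳ (f x))
  where
  others : ∀ {y} → y ∈ xs → ¬ T (p y)
  others y∈xs py = All.lookup x∉xs y∈xs (sym (only (there y∈xs) py))
∑-if-unique {xs = x ∷ xs} p f (x∉xs ∷ u) (there x₀∈xs) px₀ only with p x in eq
... | true  = ⊥-elim (All.lookup x∉xs x₀∈xs (only (here refl) (subst T (sym eq) tt)))
... | false = trans (+-identityˡ _) (∑-if-unique p f u x₀∈xs px₀ (only ∘ there))

-- Double counting ∑ₓ ∑_y [g y = x] f x in both orders.
∑-reindex : (_≟_ : DecidableEquality A) {xs : List A} {ys : List B} (g : B → A) (f : A → ℤ) →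
            Unique xs → Unique ys →
            (∀ {y} → y ∈ ys → g y ∈ xs) →
            (∀ {x} → x ∈ xs → ∃ λ y → y ∈ ys × g y ≡ x) →
            (∀ {y y′} → y ∈ ys → y′ ∈ ys → g y ≡ g y′ → y ≡ y′) →
            ∑ xs f ≡ ∑[ y ∈ ys ] f (g y)
∑-reindex _≟_ {xs} {ys} g f uxs uys g∈ g-onto g-inj = begin
  ∑ xs f                                                   ≡⟨ ∑-cong xs over-ys ⟩
  ∑[ x ∈ xs ] ∑[ y ∈ ys ] (if ⌊ g y ≟ x ⌋ then f x else 0ℤ) ≡⟨ ∑-comm xs ys _ ⟩
  ∑[ y ∈ ys ] ∑[ x ∈ xs ] (if ⌊ g y ≟ x ⌋ then f x else 0ℤ) ≡⟨ ∑-cong ys over-xs ⟩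
  ∑[ y ∈ ys ] f (g y)                                      ∎
  where
  over-ys : ∀ {x} → x ∈ xs → f x ≡ ∑[ y ∈ ys ] (if ⌊ g y ≟ x ⌋ then f x else 0ℤ)
  over-ys {x} x∈xs with y , y∈ys , gy≡x ← g-onto x∈xs =
    sym (∑-if-unique (λ y′ → ⌊ g y′ ≟ x ⌋) (λ _ → f x) uys y∈ys (fromWitness gy≡x)
          (λ y′∈ys gy′≡x → g-inj y′∈ys y∈ys (trans (toWitness gy′≡x) (sym gy≡x))))
  over-xs : ∀ {y} → y ∈ ys → ∑[ x ∈ xs ] (if ⌊ g y ≟ x ⌋ then f x else 0ℤ) ≡ f (g y)
  over-xs {y} y∈ys =
    ∑-if-unique (λ x → ⌊ g y ≟ x ⌋) f uxs (g∈ y∈ys) (fromWitness refl) (λ _ gy≡x → sym (toWitness gy≡x))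

-- Permutations as injective value tables

IsPerm : Perm k → Set
IsPerm σ = Injective _≡_ _≡_ (lookup σ)

isInjective⇒IsPerm : ∀ (σ : Perm k) → T (isInjective σ) → IsPerm σ
isInjective⇒IsPerm σ ok {i} {j} σi≡σj
  with i ≟F j | lookup σ i ≟F lookup σ j
     | All.lookup (all⁺ _ _ (All.lookup (all⁺ _ _ ok) (∈-allFin i))) (∈-allFin j)
... | yes i≡j | _        | _  = i≡j
... | no _    | yes _    | ()
... | no _    | no σi≢σj | _  = ⊥-elim (σi≢σj σi≡σj)

IsPerm⇒isInjective : ∀ (σ : Perm k) → IsPerm σ → T (isInjective σ)
IsPerm⇒isInjective σ inj with T? (isInjective σ)
... | yes ok = ok
... | no ¬ok
  with i , ¬okᵢ ← satisfied (¬All⇒Any¬ (T? ∘ _) (allFin _) (¬ok ∘ all⁻ _))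
  with j , ¬okᵢⱼ ← satisfied (¬All⇒Any¬ (T? ∘ _) (allFin _) (¬okᵢ ∘ all⁻ _))
  with i ≟F j | lookup σ i ≟F lookup σ j | ¬okᵢⱼ
... | yes _   | _         | ¬ok′ = ⊥-elim (¬ok′ tt)
... | no i≢j  | yes σi≡σj | _    = ⊥-elim (i≢j (inj σi≡σj))
... | no _    | no _      | ¬ok′ = ⊥-elim (¬ok′ tt)

∈-allVecs : ∀ {m n} (v : Vec (Fin n) m) → v ∈ allVecs m n
∈-allVecs []                = here refl
∈-allVecs {suc m} {n} (x ∷ v) =
  ∈-concatMap⁺ (λ i → map (i ∷_) (allVecs m n)) (Any.map (λ { refl → ∈-map⁺ (x ∷_) (∈-allVecs v) }) (∈-allFin x))

allVecs-unique : ∀ m n → Unique (allVecs m n)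
allVecs-unique zero    n = All.[] ∷ AllPairs.[]
allVecs-unique (suc m) n = Unique.concat⁺ (All.tabulate blocks-unique) (AllPairs.map⁺ (AllPairs.map disjoint (Unique.allFin⁺ n)))
  where
  blocks-unique : ∀ {vs} → vs ∈ map (λ i → map (i ∷_) (allVecs m n)) (allFin n) → Unique vs
  blocks-unique vs∈ with _ , _ , refl ← ∈-map⁻ _ vs∈ = Unique.map⁺ (λ { refl → refl }) (allVecs-unique m n)
  disjoint : ∀ {i j} → i ≢ j → ∀ {v} → ¬ (v ∈ map (i ∷_) (allVecs m n) × v ∈ map (j ∷_) (allVecs m n))
  disjoint i≢j (v∈ᵢ , v∈ⱼ) with _ , _ , refl ← ∈-map⁻ _ v∈ᵢ | _ , _ , eq ← ∈-map⁻ _ v∈ⱼ = i≢j (cong Vec.head eq)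

∈-perms⁺ : ∀ {σ : Perm k} → IsPerm σ → σ ∈ perms k
∈-perms⁺ {σ = σ} inj = ∈-filter⁺ (T? ∘ isInjective) (∈-allVecs σ) (IsPerm⇒isInjective σ inj)

∈-perms⁻ : ∀ {σ : Perm k} → σ ∈ perms k → IsPerm σ
∈-perms⁻ {k} {σ} σ∈ = isInjective⇒IsPerm σ (proj₂ (∈-filter⁻ (T? ∘ isInjective) {xs = allVecs k k} σ∈))

perms-unique : ∀ k → Unique (perms k)
perms-unique k = Unique.filter⁺ (T? ∘ isInjective) (allVecs-unique k k)

lookup-∘ₚ : ∀ (σ τ : Perm k) i → lookup (σ ∘ₚ τ) i ≡ lookup σ (lookup τ i)
lookup-∘ₚ σ τ = lookup∘tabulate _

Perm-ext : ∀ {σ τ : Perm k} → (∀ i → lookup σ i ≡ lookup τ i) → σ ≡ τ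
Perm-ext {σ = σ} {τ} σ≗τ = trans (sym (tabulate∘lookup σ)) (trans (tabulate-cong σ≗τ) (tabulate∘lookup τ))

∘ₚ-isPerm : ∀ (σ τ : Perm k) → IsPerm σ → IsPerm τ → IsPerm (σ ∘ₚ τ)
∘ₚ-isPerm σ τ σ-inj τ-inj {i} {j} eq =
  τ-inj (σ-inj (trans (sym (lookup-∘ₚ σ τ i)) (trans eq (lookup-∘ₚ σ τ j))))

IsPerm⇒surjective : ∀ (σ : Perm k) → IsPerm σ → ∀ y → ∃ λ x → lookup σ x ≡ y
IsPerm⇒surjective {suc k} σ inj y with any? (λ x → lookup σ x ≟F y)
... | yes hit = hit
... | no miss
  with i , j , i<j , eq ← pigeonhole (n<1+n k) (λ x → Fin.punchOut (λ y≡σx → miss (x , sym y≡σx)))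
  = ⊥-elim (<⇒≢ i<j (inj (punchOut-injective {i = y} _ _ eq)))

-- The fallback value is never used for a permutation.
preimage : Perm k → Fin k → Fin k
preimage σ y with any? (λ x → lookup σ x ≟F y)
... | yes (x , _) = x
... | no _        = y

preimage-correct : ∀ (σ : Perm k) → IsPerm σ → ∀ y → lookup σ (preimage σ y) ≡ y
preimage-correct σ inj y with any? (λ x → lookup σ x ≟F y)
... | yes (_ , σx≡y) = σx≡y
... | no miss        = ⊥-elim (miss (IsPerm⇒surjective σ inj y))

infix 30 _⁻¹
_⁻¹ : Perm k → Perm k
σ ⁻¹ = tabulate (preimage σ)

lookup-⁻¹ʳ : ∀ (σ : Perm k) → IsPerm σ → ∀ y → lookup σ (lookup (σ ⁻¹) y) ≡ y
lookup-⁻¹ʳ σ inj y = trans (cong (lookup σ) (lookup∘tabulate (preimage σ) y)) (preimage-correct σ inj y)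

lookup-⁻¹ˡ : ∀ (σ : Perm k) → IsPerm σ → ∀ x → lookup (σ ⁻¹) (lookup σ x) ≡ x
lookup-⁻¹ˡ σ inj x = inj (lookup-⁻¹ʳ σ inj (lookup σ x))

⁻¹-isPerm : ∀ (σ : Perm k) → IsPerm σ → IsPerm (σ ⁻¹)
⁻¹-isPerm σ inj {x} {y} eq = trans (sym (lookup-⁻¹ʳ σ inj x)) (trans (cong (lookup σ) eq) (lookup-⁻¹ʳ σ inj y))

∘ₚ-cancelˡ : ∀ (σ : Perm k) {τ τ′} → IsPerm σ → σ ∘ₚ τ ≡ σ ∘ₚ τ′ → τ ≡ τ′
∘ₚ-cancelˡ σ {τ} {τ′} inj eq = Perm-ext λ i →
  inj (trans (sym (lookup-∘ₚ σ τ i)) (trans (cong (λ v → lookup v i) eq) (lookup-∘ₚ σ τ′ i)))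

∘ₚ-cancelʳ : ∀ (τ : Perm k) {σ σ′} → IsPerm τ → σ ∘ₚ τ ≡ σ′ ∘ₚ τ → σ ≡ σ′
∘ₚ-cancelʳ τ {σ} {σ′} inj eq = Perm-ext λ i → begin
  lookup σ i                         ≡⟨ cong (lookup σ) (sym (lookup-⁻¹ʳ τ inj i)) ⟩
  lookup σ (lookup τ (τ⁻¹ i))        ≡⟨ sym (lookup-∘ₚ σ τ (τ⁻¹ i)) ⟩
  lookup (σ ∘ₚ τ) (τ⁻¹ i)            ≡⟨ cong (λ v → lookup v (τ⁻¹ i)) eq ⟩
  lookup (σ′ ∘ₚ τ) (τ⁻¹ i)           ≡⟨ lookup-∘ₚ σ′ τ (τ⁻¹ i) ⟩
  lookup σ′ (lookup τ (τ⁻¹ i))       ≡⟨ cong (lookup σ′) (lookup-⁻¹ʳ τ inj i) ⟩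
  lookup σ′ i                        ∎
  where
  τ⁻¹ : Fin _ → Fin _
  τ⁻¹ = lookup (τ ⁻¹)

⁻¹-solvesˡ : ∀ (σ : Perm k) → IsPerm σ → ∀ w → σ ∘ₚ (σ ⁻¹ ∘ₚ w) ≡ w
⁻¹-solvesˡ σ inj w = Perm-ext λ i →
  trans (lookup-∘ₚ σ (σ ⁻¹ ∘ₚ w) i) (trans (cong (lookup σ) (lookup-∘ₚ (σ ⁻¹) w i)) (lookup-⁻¹ʳ σ inj (lookup w i)))

⁻¹-solvesʳ : ∀ (τ : Perm k) → IsPerm τ → ∀ w → (w ∘ₚ τ ⁻¹) ∘ₚ τ ≡ w
⁻¹-solvesʳ τ inj w = Perm-ext λ i →
  trans (lookup-∘ₚ (w ∘ₚ τ ⁻¹) τ i) (trans (lookup-∘ₚ w (τ ⁻¹) _) (cong (lookup w) (lookup-⁻¹ˡ τ inj i)))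

-- Removing and inserting the last point

if-≟-yes : ∀ {x y : Fin k} (u v : A) → x ≡ y → (if ⌊ x ≟F y ⌋ then u else v) ≡ u
if-≟-yes {x = x} {y} u v x≡y with x ≟F y
... | yes _   = refl
... | no x≢y  = ⊥-elim (x≢y x≡y)

if-≟-no : ∀ {x y : Fin k} (u v : A) → x ≢ y → (if ⌊ x ≟F y ⌋ then u else v) ≡ v
if-≟-no {x = x} {y} u v x≢y with x ≟F y
... | yes x≡y = ⊥-elim (x≢y x≡y)
... | no _    = refl

inject₁≢last : ∀ (i : Fin k) → inject₁ i ≢ fromℕ k
inject₁≢last i = fromℕ≢inject₁ ∘ sym

caseLast : A → (Fin k → A) → Fin (suc k) → A
caseLast a f x with view x
... | ‵fromℕ     = a
... | ‵inject₁ i = f i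

caseLast-fromℕ : ∀ (a : A) (f : Fin k → A) → caseLast a f (fromℕ k) ≡ a
caseLast-fromℕ {k = k} a f rewrite view-fromℕ k = refl

caseLast-inject₁ : ∀ (a : A) (f : Fin k → A) i → caseLast a f (inject₁ i) ≡ f i
caseLast-inject₁ a f i rewrite view-inject₁ i = refl

-- d is a junk value for the last point.
lowerOr : Fin k → Fin (suc k) → Fin k
lowerOr d = caseLast d id

inject₁-lowerOr : ∀ (d : Fin k) {x} → x ≢ fromℕ k → inject₁ (lowerOr d x) ≡ x
inject₁-lowerOr d {x} x≢last with view x
... | ‵fromℕ     = ⊥-elim (x≢last refl)
... | ‵inject₁ i = refl

FixesLast : Perm (suc k) → Set
FixesLast {k} σ = lookup σ (fromℕ k) ≡ fromℕ k

-- σ with the last point cut out of its cycle.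
skipLast : Perm (suc k) → Fin (suc k) → Fin (suc k)
skipLast {k} σ x = if ⌊ lookup σ x ≟F fromℕ k ⌋ then lookup σ (fromℕ k) else lookup σ x

skipLast-last : ∀ (σ : Perm (suc k)) x → lookup σ x ≡ fromℕ k → skipLast σ x ≡ lookup σ (fromℕ k)
skipLast-last σ x = if-≟-yes _ _

skipLast-other : ∀ (σ : Perm (suc k)) x → lookup σ x ≢ fromℕ k → skipLast σ x ≡ lookup σ x
skipLast-other σ x = if-≟-no _ _

skipLast-≢last : ∀ (σ : Perm (suc k)) → IsPerm σ → ∀ {x} → x ≢ fromℕ k → skipLast σ x ≢ fromℕ k
skipLast-≢last {k} σ inj {x} x≢last with lookup σ x ≟F fromℕ k
... | yes σx≡last = λ σlast≡last → x≢last (inj (trans σx≡last (sym σlast≡last)))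
... | no σx≢last  = σx≢last

skipLast-injective : ∀ (σ : Perm (suc k)) → IsPerm σ → ∀ {x y} → x ≢ fromℕ k → y ≢ fromℕ k →
                     skipLast σ x ≡ skipLast σ y → x ≡ y
skipLast-injective {k} σ inj {x} {y} x≢last y≢last eq
  with lookup σ x ≟F fromℕ k | lookup σ y ≟F fromℕ k
... | yes σx≡last | yes σy≡last = inj (trans σx≡last (sym σy≡last))
... | yes _       | no _        = ⊥-elim (y≢last (sym (inj eq)))
... | no _        | yes _       = ⊥-elim (x≢last (inj eq))
... | no _        | no _        = inj eq

removeLast : Perm (suc k) → Perm k
removeLast σ = tabulate (λ i → lowerOr i (skipLast σ (inject₁ i)))

inject₁-removeLast : ∀ (σ : Perm (suc k)) → IsPerm σ → ∀ i →
                     inject₁ (lookup (removeLast σ) i) ≡ skipLast σ (inject₁ i)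
inject₁-removeLast σ inj i =
  trans (cong inject₁ (lookup∘tabulate _ i)) (inject₁-lowerOr i (skipLast-≢last σ inj (inject₁≢last i)))

removeLast-isPerm : ∀ (σ : Perm (suc k)) → IsPerm σ → IsPerm (removeLast σ)
removeLast-isPerm σ inj {i} {j} eq = inject₁-injective
  (skipLast-injective σ inj (inject₁≢last i) (inject₁≢last j)
    (trans (sym (inject₁-removeLast σ inj i)) (trans (cong inject₁ eq) (inject₁-removeLast σ inj j))))

redirect : Fin (suc k) → Fin (suc k) → Fin (suc k)
redirect {k} j y = if ⌊ y ≟F j ⌋ then fromℕ k else y

redirect-hit : ∀ (j : Fin (suc k)) {y} → y ≡ j → redirect j y ≡ fromℕ k
redirect-hit j = if-≟-yes _ _

redirect-miss : ∀ (j : Fin (suc k)) {y} → y ≢ j → redirect j y ≡ y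
redirect-miss j = if-≟-no _ _

redirect-≢ : ∀ (j : Fin (suc k)) {y} → y ≢ fromℕ k → redirect j y ≢ j
redirect-≢ j {y} y≢last with y ≟F j
... | yes y≡j = λ last≡j → y≢last (trans y≡j (sym last≡j))
... | no y≢j  = y≢j

redirect-injective : ∀ (j : Fin (suc k)) {y y′} → y ≢ fromℕ k → y′ ≢ fromℕ k →
                     redirect j y ≡ redirect j y′ → y ≡ y′
redirect-injective j {y} {y′} y≢last y′≢last eq with y ≟F j | y′ ≟F j
... | yes y≡j | yes y′≡j = trans y≡j (sym y′≡j)
... | yes _   | no _     = ⊥-elim (y′≢last (sym eq))
... | no _    | yes _    = ⊥-elim (y≢last eq)
... | no _    | no _     = eq

-- ρ with the last point inserted into its cycle just before j (as a new fixed point if j is the last point).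
insertLast : Perm k → Fin (suc k) → Perm (suc k)
insertLast ρ j = tabulate (caseLast j (redirect j ∘ inject₁ ∘ lookup ρ))

lookup-insertLast-last : ∀ (ρ : Perm k) j → lookup (insertLast ρ j) (fromℕ k) ≡ j
lookup-insertLast-last {k} ρ j = trans (lookup∘tabulate image (fromℕ k)) (caseLast-fromℕ j (redirect j ∘ inject₁ ∘ lookup ρ))
  where image = caseLast j (redirect j ∘ inject₁ ∘ lookup ρ)

lookup-insertLast-inject₁ : ∀ (ρ : Perm k) j i →
                            lookup (insertLast ρ j) (inject₁ i) ≡ redirect j (inject₁ (lookup ρ i))
lookup-insertLast-inject₁ ρ j i = trans (lookup∘tabulate image (inject₁ i)) (caseLast-inject₁ j (redirect j ∘ inject₁ ∘ lookup ρ) i)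
  where image = caseLast j (redirect j ∘ inject₁ ∘ lookup ρ)

insertLast-isPerm : ∀ (ρ : Perm k) j → IsPerm ρ → IsPerm (insertLast ρ j)
insertLast-isPerm ρ j inj {x} {y} eq with view x | view y
... | ‵fromℕ     | ‵fromℕ      = refl
... | ‵fromℕ     | ‵inject₁ i  = ⊥-elim (redirect-≢ j (inject₁≢last (lookup ρ i))
                                   (sym (trans (sym (lookup-insertLast-last ρ j)) (trans eq (lookup-insertLast-inject₁ ρ j i)))))
... | ‵inject₁ i | ‵fromℕ      = ⊥-elim (redirect-≢ j (inject₁≢last (lookup ρ i))
                                   (trans (sym (lookup-insertLast-inject₁ ρ j i)) (trans eq (lookup-insertLast-last ρ j))))
... | ‵inject₁ i | ‵inject₁ i′ = cong inject₁ (inj (inject₁-injective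
                                   (redirect-injective j (inject₁≢last _) (inject₁≢last _)
                                     (trans (sym (lookup-insertLast-inject₁ ρ j i)) (trans eq (lookup-insertLast-inject₁ ρ j i′))))))

removeLast-insertLast : ∀ (ρ : Perm k) j → IsPerm ρ → removeLast (insertLast ρ j) ≡ ρ
removeLast-insertLast ρ j inj = Perm-ext λ i → inject₁-injective
  (trans (inject₁-removeLast σ (insertLast-isPerm ρ j inj) i) (skip i))
  where
  σ = insertLast ρ j
  skip : ∀ i → skipLast σ (inject₁ i) ≡ inject₁ (lookup ρ i)
  skip i with inject₁ (lookup ρ i) ≟F j
  ... | yes ρi≡j = begin
    skipLast σ (inject₁ i) ≡⟨ skipLast-last σ (inject₁ i) (trans (lookup-insertLast-inject₁ ρ j i) (redirect-hit j ρi≡j)) ⟩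
    lookup σ (fromℕ _)     ≡⟨ lookup-insertLast-last ρ j ⟩
    j                      ≡⟨ sym ρi≡j ⟩
    inject₁ (lookup ρ i)   ∎
  ... | no ρi≢j = trans (skipLast-other σ (inject₁ i) (λ σi≡last → inject₁≢last _ (trans (sym σi) σi≡last))) σi
    where
    σi : lookup σ (inject₁ i) ≡ inject₁ (lookup ρ i)
    σi = trans (lookup-insertLast-inject₁ ρ j i) (redirect-miss j ρi≢j)

insertLast-removeLast : ∀ (σ : Perm (suc k)) → IsPerm σ → insertLast (removeLast σ) (lookup σ (fromℕ k)) ≡ σ
insertLast-removeLast {k} σ inj = Perm-ext point
  where
  j = lookup σ (fromℕ k)
  point : ∀ x → lookup (insertLast (removeLast σ) j) x ≡ lookup σ x
  point x with view x
  ... | ‵fromℕ     = lookup-insertLast-last (removeLast σ) j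
  ... | ‵inject₁ i = trans (lookup-insertLast-inject₁ (removeLast σ) j i)
                       (trans (cong (redirect j) (inject₁-removeLast σ inj i)) (undo (lookup σ (inject₁ i) ≟F fromℕ k)))
    where
    undo : Dec (lookup σ (inject₁ i) ≡ fromℕ k) → redirect j (skipLast σ (inject₁ i)) ≡ lookup σ (inject₁ i)
    undo (yes σi≡last) = trans (cong (redirect j) (skipLast-last σ (inject₁ i) σi≡last)) (trans (redirect-hit j refl) (sym σi≡last))
    undo (no σi≢last)  = trans (cong (redirect j) (skipLast-other σ (inject₁ i) σi≢last))
                           (redirect-miss j (λ σi≡j → inject₁≢last i (inj σi≡j)))

-- Cycles

iter-+ : ∀ (σ : Perm k) m n x → iter σ (m ℕ.+ n) x ≡ iter σ m (iter σ n x)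
iter-+ σ zero    n x = refl
iter-+ σ (suc m) n x = cong (lookup σ) (iter-+ σ m n x)

iter-sucʳ : ∀ (σ : Perm k) n x → iter σ (suc n) x ≡ iter σ n (lookup σ x)
iter-sucʳ σ n x = trans (cong (λ m → iter σ m x) (ℕ.+-comm 1 n)) (iter-+ σ n 1 x)

iter-injective : ∀ (σ : Perm k) → IsPerm σ → ∀ m {x y} → iter σ m x ≡ iter σ m y → x ≡ y
iter-injective σ inj zero    eq = eq
iter-injective σ inj (suc m) eq = iter-injective σ inj m (inj eq)

iter-fixed : ∀ (σ : Perm k) {x} → lookup σ x ≡ x → ∀ j → iter σ j x ≡ x
iter-fixed σ σx≡x zero    = refl
iter-fixed σ σx≡x (suc j) = trans (cong (lookup σ) (iter-fixed σ σx≡x j)) σx≡x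

iter-period : ∀ (σ : Perm k) → IsPerm σ → ∀ x → ∃ λ p → 0 < p × p ≤ k × iter σ p x ≡ x
iter-period {k} σ inj x
  with a , b , a<b , eq ← pigeonhole (n<1+n k) (λ (j : Fin (suc k)) → iter σ (toℕ j) x)
  = toℕ b ∸ toℕ a , m<n⇒0<n∸m a<b , ≤-trans (m∸n≤m (toℕ b) (toℕ a)) (≤-pred (toℕ<n b)) ,
    iter-injective σ inj (toℕ a) (sym (trans eq shift))
  where
  shift : iter σ (toℕ b) x ≡ iter σ (toℕ a) (iter σ (toℕ b ∸ toℕ a) x)
  shift = trans (cong (λ n → iter σ n x) (sym (m+[n∸m]≡n (<⇒≤ a<b)))) (iter-+ σ (toℕ a) (toℕ b ∸ toℕ a) x)

iter-multiple : ∀ (σ : Perm k) p {x} → iter σ p x ≡ x → ∀ t → iter σ (t ℕ.* p) x ≡ x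
iter-multiple σ p eq zero    = refl
iter-multiple σ p {x} eq (suc t) = trans (iter-+ σ p (t ℕ.* p) x) (trans (cong (iter σ p) (iter-multiple σ p eq t)) eq)

iter-mod : ∀ (σ : Perm k) → IsPerm σ → ∀ x j → ∃ λ j′ → j′ < k × iter σ j x ≡ iter σ j′ x
iter-mod σ inj x j with iter-period σ inj x
... | p@(suc _) , _ , p≤k , period = j % p , <-≤-trans (m%n<n j p) p≤k , (begin
  iter σ j x                               ≡⟨ cong (λ n → iter σ n x) (m≡m%n+[m/n]*n j p) ⟩
  iter σ (j % p ℕ.+ (j / p) ℕ.* p) x       ≡⟨ iter-+ σ (j % p) _ x ⟩
  iter σ (j % p) (iter σ ((j / p) ℕ.* p) x) ≡⟨ cong (iter σ (j % p)) (iter-multiple σ p period (j / p)) ⟩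
  iter σ (j % p) x                         ∎)

isCycleMin⇒ : ∀ (σ : Perm k) → IsPerm σ → ∀ {x} → T (isCycleMin σ x) → ∀ j → toℕ x ≤ toℕ (iter σ j x)
isCycleMin⇒ {k} σ inj {x} min j with j′ , j′<k , eq ← iter-mod σ inj x j =
  subst (λ y → toℕ x ≤ toℕ y) (sym eq) (≤ᵇ⇒≤ _ _ (All.lookup (all⁺ _ (upTo k) min) (∈-upTo⁺ j′<k)))

⇒isCycleMin : ∀ (σ : Perm k) {x} → (∀ j → toℕ x ≤ toℕ (iter σ j x)) → T (isCycleMin σ x)
⇒isCycleMin {k} σ below = all⁻ _ {upTo k} (All.tabulate (λ {j} _ → ≤⇒≤ᵇ (below j)))

T-ext : ∀ {a b : Bool} → (T a → T b) → (T b → T a) → a ≡ b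
T-ext {false} {false} _   _   = refl
T-ext {false} {true}  _   b⇒a = ⊥-elim (b⇒a tt)
T-ext {true}  {false} a⇒b _   = ⊥-elim (a⇒b tt)
T-ext {true}  {true}  _   _   = refl

boolToℕ : Bool → ℕ
boolToℕ b = if b then 1 else 0

length-filterᵇ-tabulate-last : ∀ (p : A → Bool) (g : Fin (suc k) → A) →
  length (filterᵇ p (List.tabulate g)) ≡ length (filterᵇ p (List.tabulate (g ∘ inject₁))) ℕ.+ boolToℕ (p (g (fromℕ k)))
length-filterᵇ-tabulate-last {k = zero}  p g with p (g Fin.zero)
... | true  = refl
... | false = refl
length-filterᵇ-tabulate-last {k = suc k} p g with p (g Fin.zero)
... | true  = cong suc (length-filterᵇ-tabulate-last p (g ∘ Fin.suc))
... | false = length-filterᵇ-tabulate-last p (g ∘ Fin.suc)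

length-filterᵇ-tabulate-cong : ∀ (p : A → Bool) (q : B → Bool) (g : Fin k → A) (h : Fin k → B) →
  (∀ i → p (g i) ≡ q (h i)) → length (filterᵇ p (List.tabulate g)) ≡ length (filterᵇ q (List.tabulate h))
length-filterᵇ-tabulate-cong {k = zero}  p q g h eq = refl
length-filterᵇ-tabulate-cong {k = suc k} p q g h eq with p (g Fin.zero) | q (h Fin.zero) | eq Fin.zero
... | true  | true  | _ = cong suc (length-filterᵇ-tabulate-cong p q (g ∘ Fin.suc) (h ∘ Fin.suc) (eq ∘ Fin.suc))
... | false | false | _ = length-filterᵇ-tabulate-cong p q (g ∘ Fin.suc) (h ∘ Fin.suc) (eq ∘ Fin.suc)

-- A step of removeLast σ is one step of σ, or two when it passes through the last point,
-- so the orbit of i under removeLast σ is that of inject₁ i under σ without the last point.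
module _ (σ : Perm (suc k)) (inj : IsPerm σ) (i : Fin k) where
  private
    ρ = removeLast σ

  removeLast-orbit⊆ : ∀ j → ∃ λ j′ → inject₁ (iter ρ j i) ≡ iter σ j′ (inject₁ i)
  removeLast-orbit⊆ zero = 0 , refl
  removeLast-orbit⊆ (suc j) with j′ , eq ← removeLast-orbit⊆ j | lookup σ (inject₁ (iter ρ j i)) ≟F fromℕ k
  ... | yes σy≡last = suc (suc j′) , (begin
    inject₁ (lookup ρ (iter ρ j i))            ≡⟨ inject₁-removeLast σ inj _ ⟩
    skipLast σ (inject₁ (iter ρ j i))          ≡⟨ skipLast-last σ _ σy≡last ⟩
    lookup σ (fromℕ k)                         ≡⟨ cong (lookup σ) (sym σy≡last) ⟩
    lookup σ (lookup σ (inject₁ (iter ρ j i))) ≡⟨ cong (lookup σ ∘ lookup σ) eq ⟩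
    iter σ (suc (suc j′)) (inject₁ i)          ∎)
  ... | no σy≢last = suc j′ ,
    trans (inject₁-removeLast σ inj _) (trans (skipLast-other σ _ σy≢last) (cong (lookup σ) eq))

  removeLast-orbit⊇ : ∀ j → ∃ λ j′ → iter σ j (inject₁ i) ≡ inject₁ (iter ρ j′ i)
                                    ⊎ iter σ j (inject₁ i) ≡ fromℕ k × lookup σ (fromℕ k) ≡ inject₁ (iter ρ (suc j′) i)
  removeLast-orbit⊇ zero = 0 , inj₁ refl
  removeLast-orbit⊇ (suc j) with removeLast-orbit⊇ j
  ... | j′ , inj₂ (atLast , σlast) = suc j′ , inj₁ (trans (cong (lookup σ) atLast) σlast)
  ... | j′ , inj₁ eq with lookup σ (inject₁ (iter ρ j′ i)) ≟F fromℕ k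
  ...   | yes σy≡last = j′ , inj₂ (trans (cong (lookup σ) eq) σy≡last ,
                                  sym (trans (inject₁-removeLast σ inj _) (skipLast-last σ _ σy≡last)))
  ...   | no σy≢last  = suc j′ , inj₁ (trans (cong (lookup σ) eq)
                                  (sym (trans (inject₁-removeLast σ inj _) (skipLast-other σ _ σy≢last))))

  isCycleMin-inject₁ : isCycleMin σ (inject₁ i) ≡ isCycleMin ρ i
  isCycleMin-inject₁ = T-ext
    (λ min → ⇒isCycleMin ρ λ j → let j′ , eq = removeLast-orbit⊆ j in
      subst₂ _≤_ (toℕ-inject₁ i) (trans (cong toℕ (sym eq)) (toℕ-inject₁ _)) (isCycleMin⇒ σ inj min j′))
    (λ min → ⇒isCycleMin σ λ j → above (removeLast-orbit⊇ j) (isCycleMin⇒ ρ (removeLast-isPerm σ inj) min))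
    where
    above : ∀ {y} → (∃ λ j′ → y ≡ inject₁ (iter ρ j′ i) ⊎ y ≡ fromℕ k × lookup σ (fromℕ k) ≡ inject₁ (iter ρ (suc j′) i)) →
            (∀ j → toℕ i ≤ toℕ (iter ρ j i)) → toℕ (inject₁ i) ≤ toℕ y
    above (j′ , inj₁ refl)       min = subst₂ _≤_ (sym (toℕ-inject₁ i)) (sym (toℕ-inject₁ _)) (min j′)
    above (_  , inj₂ (refl , _)) _   = subst₂ _≤_ (sym (toℕ-inject₁ i)) (sym (toℕ-fromℕ k)) (<⇒≤ (toℕ<n i))

-- The last point is the largest, so it is the minimum of its cycle only when it is fixed.
isCycleMin-last : ∀ (σ : Perm (suc k)) → IsPerm σ → isCycleMin σ (fromℕ k) ≡ ⌊ lookup σ (fromℕ k) ≟F fromℕ k ⌋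
isCycleMin-last {k} σ inj = T-ext
  (λ min → fromWitness (toℕ-injective (≤-antisym
     (subst (toℕ (lookup σ (fromℕ k)) ≤_) (sym (toℕ-fromℕ k)) (≤-pred (toℕ<n (lookup σ (fromℕ k)))))
     (isCycleMin⇒ σ inj min 1))))
  (λ fixed → ⇒isCycleMin σ λ j → ≤-reflexive (cong toℕ (sym (iter-fixed σ (toWitness fixed) j))))

κ-removeLast : ∀ (σ : Perm (suc k)) → IsPerm σ →
               κ σ ≡ κ (removeLast σ) ℕ.+ boolToℕ ⌊ lookup σ (fromℕ k) ≟F fromℕ k ⌋
κ-removeLast σ inj = trans (length-filterᵇ-tabulate-last (isCycleMin σ) id)
  (cong₂ ℕ._+_ (length-filterᵇ-tabulate-cong (isCycleMin σ) (isCycleMin (removeLast σ)) inject₁ id (isCycleMin-inject₁ σ inj))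
               (cong boolToℕ (isCycleMin-last σ inj)))

κ-insertLast : ∀ (ρ : Perm k) j → IsPerm ρ → κ (insertLast ρ j) ≡ κ ρ ℕ.+ boolToℕ ⌊ j ≟F fromℕ k ⌋
κ-insertLast {k} ρ j inj = trans (κ-removeLast (insertLast ρ j) (insertLast-isPerm ρ j inj))
  (cong₂ ℕ._+_ (cong κ (removeLast-insertLast ρ j inj)) (cong (λ y → boolToℕ ⌊ y ≟F fromℕ k ⌋) (lookup-insertLast-last ρ j)))

-- Counting permutations by their number of cycles

∑-tabulate-last : ∀ (g : Fin (suc k) → A) (f : A → ℤ) →
                  ∑ (List.tabulate g) f ≡ ∑ (List.tabulate (g ∘ inject₁)) f + f (g (fromℕ k))
∑-tabulate-last {k = zero}  g f = trans (+-identityʳ (f (g Fin.zero))) (sym (+-identityˡ (f (g Fin.zero))))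
∑-tabulate-last {k = suc k} g f =
  trans (cong (_+_ (f (g Fin.zero))) (∑-tabulate-last (g ∘ Fin.suc) f)) (sym (+-assoc (f (g Fin.zero)) _ _))

∑-one : ∀ (xs : List A) → ∑[ _ ∈ xs ] 1ℤ ≡ + length xs
∑-one []       = refl
∑-one (x ∷ xs) = cong (_+_ 1ℤ) (∑-one xs)

∑-pow-isLast : ∀ k (x : ℤ) → ∑[ j ∈ allFin (suc k) ] x ^ boolToℕ ⌊ j ≟F fromℕ k ⌋ ≡ + k + x
∑-pow-isLast k x = begin
  ∑[ j ∈ allFin (suc k) ] x ^ isLast j                    ≡⟨ ∑-tabulate-last id (λ j → x ^ isLast j) ⟩
  (∑[ j ∈ nonLast ] x ^ isLast j) + x ^ isLast (fromℕ k)  ≡⟨ cong₂ _+_ others last ⟩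
  + k + x                                                 ∎
  where
  nonLast : List (Fin (suc k))
  nonLast = List.tabulate inject₁
  isLast : Fin (suc k) → ℕ
  isLast j = boolToℕ ⌊ j ≟F fromℕ k ⌋
  notLast : ∀ {j} → j ∈ nonLast → x ^ isLast j ≡ 1ℤ
  notLast j∈ with i , refl ← ∈-tabulate⁻ j∈ = cong (x ^_) (if-≟-no 1 0 (inject₁≢last i))
  others : ∑[ j ∈ nonLast ] x ^ isLast j ≡ + k
  others = begin
    ∑[ j ∈ nonLast ] x ^ isLast j  ≡⟨ ∑-cong nonLast notLast ⟩
    ∑[ j ∈ nonLast ] 1ℤ            ≡⟨ ∑-one nonLast ⟩
    + length nonLast               ≡⟨ cong +_ (length-tabulate inject₁) ⟩
    + k                            ∎
  last : x ^ isLast (fromℕ k) ≡ x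
  last = trans (cong (x ^_) (if-≟-yes {x = fromℕ k} 1 0 refl)) (^-identityʳ x)

∑-perms-suc : ∀ k (f : Perm (suc k) → ℤ) →
              ∑ (perms (suc k)) f ≡ ∑[ ρ ∈ perms k ] ∑[ j ∈ allFin (suc k) ] f (insertLast ρ j)
∑-perms-suc k f = trans
  (∑-reindex (≡-dec _≟F_) (uncurry insertLast) f (perms-unique (suc k))
     (Unique.cartesianProduct⁺ (perms-unique k) (Unique.allFin⁺ (suc k))) inserted hit injective)
  (∑-cartesianProduct (perms k) (allFin (suc k)) (f ∘ uncurry insertLast))
  where
  pairs = cartesianProduct (perms k) (allFin (suc k))
  ρ-perm : ∀ {ρ j} → (ρ , j) ∈ pairs → IsPerm ρ
  ρ-perm p∈ = ∈-perms⁻ (proj₁ (∈-cartesianProduct⁻ (perms k) (allFin (suc k)) p∈))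
  inserted : ∀ {p} → p ∈ pairs → uncurry insertLast p ∈ perms (suc k)
  inserted {ρ , j} p∈ = ∈-perms⁺ (insertLast-isPerm ρ j (ρ-perm p∈))
  hit : ∀ {σ} → σ ∈ perms (suc k) → ∃ λ p → p ∈ pairs × uncurry insertLast p ≡ σ
  hit {σ} σ∈ = (removeLast σ , lookup σ (fromℕ k)) ,
    ∈-cartesianProduct⁺ (∈-perms⁺ (removeLast-isPerm σ (∈-perms⁻ σ∈))) (∈-allFin _) ,
    insertLast-removeLast σ (∈-perms⁻ σ∈)
  injective : ∀ {p p′} → p ∈ pairs → p′ ∈ pairs → uncurry insertLast p ≡ uncurry insertLast p′ → p ≡ p′
  injective {ρ , j} {ρ′ , j′} p∈ p′∈ eq = cong₂ _,_
    (trans (sym (removeLast-insertLast ρ j (ρ-perm p∈))) (trans (cong removeLast eq) (removeLast-insertLast ρ′ j′ (ρ-perm p′∈))))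
    (trans (sym (lookup-insertLast-last ρ j)) (trans (cong (λ σ → lookup σ (fromℕ k)) eq) (lookup-insertLast-last ρ′ j′)))

∑-κ-rising : ∀ k (x : ℤ) → ∑[ σ ∈ perms k ] x ^ κ σ ≡ rising x k
∑-κ-rising zero    x = refl
∑-κ-rising (suc k) x = begin
  ∑[ σ ∈ perms (suc k) ] x ^ κ σ                                     ≡⟨ ∑-perms-suc k (λ σ → x ^ κ σ) ⟩
  ∑[ ρ ∈ perms k ] ∑[ j ∈ allFin (suc k) ] x ^ κ (insertLast ρ j)   ≡⟨ ∑-cong (perms k) split ⟩
  ∑[ ρ ∈ perms k ] (+ k + x) * x ^ κ ρ                              ≡⟨ ∑-*ˡ (perms k) (+ k + x) (λ ρ → x ^ κ ρ) ⟩
  (+ k + x) * (∑[ ρ ∈ perms k ] x ^ κ ρ)                            ≡⟨ cong (_*_ (+ k + x)) (∑-κ-rising k x) ⟩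
  (+ k + x) * rising x k                                            ≡⟨ *-comm (+ k + x) (rising x k) ⟩
  rising x k * (+ k + x)                                            ≡⟨ cong (_*_ (rising x k)) (+-comm (+ k) x) ⟩
  rising x (suc k)                                                  ∎
  where
  split : ∀ {ρ} → ρ ∈ perms k → ∑[ j ∈ allFin (suc k) ] x ^ κ (insertLast ρ j) ≡ (+ k + x) * x ^ κ ρ
  split {ρ} ρ∈ = begin
    ∑[ j ∈ allFin (suc k) ] x ^ κ (insertLast ρ j)
      ≡⟨ ∑-cong (allFin (suc k)) (λ {j} _ → trans (cong (x ^_) (κ-insertLast ρ j (∈-perms⁻ ρ∈))) (^-distribˡ-+-* x (κ ρ) _)) ⟩
    ∑[ j ∈ allFin (suc k) ] x ^ κ ρ * x ^ boolToℕ ⌊ j ≟F fromℕ k ⌋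
      ≡⟨ ∑-*ˡ (allFin (suc k)) (x ^ κ ρ) _ ⟩
    x ^ κ ρ * (∑[ j ∈ allFin (suc k) ] x ^ boolToℕ ⌊ j ≟F fromℕ k ⌋)
      ≡⟨ cong (_*_ (x ^ κ ρ)) (∑-pow-isLast k x) ⟩
    x ^ κ ρ * (+ k + x)
      ≡⟨ *-comm (x ^ κ ρ) (+ k + x) ⟩
    (+ k + x) * x ^ κ ρ ∎

-- The sign of a permutation

sgn : ℕ → ℤ
sgn n = -1ℤ ^ n

-- (-1)^(k - κ σ), written with k + κ σ to avoid truncated subtraction.
ε : Perm k → ℤ
ε {k} σ = sgn (k ℕ.+ κ σ)

sgn-+ : ∀ m n → sgn (m ℕ.+ n) ≡ sgn m * sgn n
sgn-+ = ^-distribˡ-+-* -1ℤ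

sgn-square : ∀ n → sgn n * sgn n ≡ 1ℤ
sgn-square zero    = refl
sgn-square (suc n) = trans (square-neg (sgn n)) (sgn-square n)
  where
  square-neg : ∀ s → (-1ℤ * s) * (-1ℤ * s) ≡ s * s
  square-neg = solve-∀

lastSign : Perm (suc k) → ℤ
lastSign {k} σ = if ⌊ lookup σ (fromℕ k) ≟F fromℕ k ⌋ then 1ℤ else -1ℤ

lastSign-fixed : ∀ (σ : Perm (suc k)) → FixesLast σ → lastSign σ ≡ 1ℤ
lastSign-fixed σ = if-≟-yes 1ℤ -1ℤ

lastSign-moved : ∀ (σ : Perm (suc k)) → ¬ FixesLast σ → lastSign σ ≡ -1ℤ
lastSign-moved σ = if-≟-no 1ℤ -1ℤ

ε-removeLast : ∀ (σ : Perm (suc k)) → IsPerm σ → ε σ ≡ ε (removeLast σ) * lastSign σ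
ε-removeLast {k} σ inj = begin
  sgn (suc k ℕ.+ κ σ)                       ≡⟨ cong (λ n → sgn (suc k ℕ.+ n)) (κ-removeLast σ inj) ⟩
  sgn (suc k ℕ.+ (κ ρ ℕ.+ boolToℕ fixed))   ≡⟨ cong sgn (shuffle k (κ ρ) (boolToℕ fixed)) ⟩
  sgn (k ℕ.+ κ ρ ℕ.+ suc (boolToℕ fixed))   ≡⟨ sgn-+ (k ℕ.+ κ ρ) _ ⟩
  ε ρ * sgn (suc (boolToℕ fixed))           ≡⟨ cong (_*_ (ε ρ)) (sgn-suc-boolToℕ fixed) ⟩
  ε ρ * lastSign σ                          ∎
  where
  ρ = removeLast σ
  fixed = ⌊ lookup σ (fromℕ k) ≟F fromℕ k ⌋
  shuffle : ∀ k m b → suc k ℕ.+ (m ℕ.+ b) ≡ k ℕ.+ m ℕ.+ suc b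
  shuffle k m b = trans (cong suc (sym (ℕ.+-assoc k m b))) (sym (ℕ.+-suc (k ℕ.+ m) b))
  sgn-suc-boolToℕ : ∀ b → sgn (suc (boolToℕ b)) ≡ (if b then 1ℤ else -1ℤ)
  sgn-suc-boolToℕ true  = refl
  sgn-suc-boolToℕ false = refl

removeLast-restricts : ∀ (σ : Perm (suc k)) → IsPerm σ → FixesLast σ →
                    ∀ i → inject₁ (lookup (removeLast σ) i) ≡ lookup σ (inject₁ i)
removeLast-restricts σ inj σL≡L i = trans (inject₁-removeLast σ inj i)
  (skipLast-other σ _ (λ σi≡L → inject₁≢last i (inj (trans σi≡L (sym σL≡L)))))

idₚ : ∀ k → Perm k
idₚ k = tabulate id

lookup-idₚ : ∀ (i : Fin k) → lookup (idₚ k) i ≡ i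
lookup-idₚ = lookup∘tabulate id

idₚ-isPerm : IsPerm (idₚ k)
idₚ-isPerm {x = x} {y} eq = trans (sym (lookup-idₚ x)) (trans eq (lookup-idₚ y))

ε-idₚ : ∀ k → ε (idₚ k) ≡ 1ℤ
ε-idₚ zero    = refl
ε-idₚ (suc k) = begin
  ε id′                            ≡⟨ ε-removeLast id′ idₚ-isPerm ⟩
  ε (removeLast id′) * lastSign id′ ≡⟨ cong₂ _*_ (cong ε restrict) (lastSign-fixed id′ (lookup-idₚ (fromℕ k))) ⟩
  ε (idₚ k) * 1ℤ                   ≡⟨ cong (_* 1ℤ) (ε-idₚ k) ⟩
  1ℤ                               ∎
  where
  id′ = idₚ (suc k)
  restrict : removeLast id′ ≡ idₚ k
  restrict = Perm-ext λ i → inject₁-injective (begin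
    inject₁ (lookup (removeLast id′) i) ≡⟨ removeLast-restricts id′ idₚ-isPerm (lookup-idₚ (fromℕ k)) i ⟩
    lookup id′ (inject₁ i)              ≡⟨ lookup-idₚ (inject₁ i) ⟩
    inject₁ i                           ≡⟨ cong inject₁ (sym (lookup-idₚ i)) ⟩
    inject₁ (lookup (idₚ k) i)          ∎)

swap : Fin k → Fin k → Fin k → Fin k
swap c b z = if ⌊ z ≟F c ⌋ then b else if ⌊ z ≟F b ⌋ then c else z

swap-≡ˡ : ∀ (c b : Fin k) {z} → z ≡ c → swap c b z ≡ b
swap-≡ˡ c b = if-≟-yes _ _

swap-≡ʳ : ∀ (c b : Fin k) {z} → z ≢ c → z ≡ b → swap c b z ≡ c
swap-≡ʳ c b {z} z≢c z≡b = trans (if-≟-no _ _ z≢c) (if-≟-yes {x = z} c z z≡b)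

swap-≢ : ∀ (c b : Fin k) {z} → z ≢ c → z ≢ b → swap c b z ≡ z
swap-≢ c b {z} z≢c z≢b = trans (if-≟-no _ _ z≢c) (if-≟-no {x = z} c z z≢b)

swap-at-b : ∀ (c b : Fin k) → swap c b b ≡ c
swap-at-b c b with b ≟F c
... | yes b≡c = b≡c
... | no _    = if-≟-yes {x = b} c b refl

swap-involutive : ∀ (c b z : Fin k) → swap c b (swap c b z) ≡ z
swap-involutive c b z = go (z ≟F c) (z ≟F b)
  where
  go : Dec (z ≡ c) → Dec (z ≡ b) → swap c b (swap c b z) ≡ z
  go (yes z≡c) _         = trans (cong (swap c b) (swap-≡ˡ c b z≡c)) (trans (swap-at-b c b) (sym z≡c))
  go (no z≢c)  (yes z≡b) = trans (cong (swap c b) (swap-≡ʳ c b z≢c z≡b)) (trans (swap-≡ˡ c b refl) (sym z≡b))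
  go (no z≢c)  (no z≢b)  = trans (cong (swap c b) (swap-≢ c b z≢c z≢b)) (swap-≢ c b z≢c z≢b)

swap-comm : ∀ {c b : Fin k} → c ≢ b → ∀ z → swap c b z ≡ swap b c z
swap-comm {c = c} {b} c≢b z = go (z ≟F c) (z ≟F b)
  where
  go : Dec (z ≡ c) → Dec (z ≡ b) → swap c b z ≡ swap b c z
  go (yes z≡c) (yes z≡b) = ⊥-elim (c≢b (trans (sym z≡c) z≡b))
  go (yes z≡c) (no z≢b)  = trans (swap-≡ˡ c b z≡c) (sym (swap-≡ʳ b c z≢b z≡c))
  go (no z≢c)  (yes z≡b) = trans (swap-≡ʳ c b z≢c z≡b) (sym (swap-≡ˡ b c z≡b))
  go (no z≢c)  (no z≢b)  = trans (swap-≢ c b z≢c z≢b) (sym (swap-≢ b c z≢b z≢c))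

swap-inject₁ : ∀ (c b i : Fin k) → swap (inject₁ c) (inject₁ b) (inject₁ i) ≡ inject₁ (swap c b i)
swap-inject₁ c b i = go (i ≟F c) (i ≟F b)
  where
  go : Dec (i ≡ c) → Dec (i ≡ b) → swap (inject₁ c) (inject₁ b) (inject₁ i) ≡ inject₁ (swap c b i)
  go (yes i≡c) _         = trans (swap-≡ˡ _ _ (cong inject₁ i≡c)) (cong inject₁ (sym (swap-≡ˡ c b i≡c)))
  go (no i≢c)  (yes i≡b) = trans (swap-≡ʳ _ _ (i≢c ∘ inject₁-injective) (cong inject₁ i≡b)) (cong inject₁ (sym (swap-≡ʳ c b i≢c i≡b)))
  go (no i≢c)  (no i≢b)  = trans (swap-≢ _ _ (i≢c ∘ inject₁-injective) (i≢b ∘ inject₁-injective)) (cong inject₁ (sym (swap-≢ c b i≢c i≢b)))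

transposition : Fin k → Fin k → Perm k
transposition c b = tabulate (swap c b)

lookup-transposition : ∀ (c b z : Fin k) → lookup (transposition c b) z ≡ swap c b z
lookup-transposition c b = lookup∘tabulate (swap c b)

transposition-isPerm : ∀ (c b : Fin k) → IsPerm (transposition c b)
transposition-isPerm c b {x} {y} eq = begin
  x                                                 ≡⟨ sym (swap-involutive c b x) ⟩
  swap c b (swap c b x)                             ≡⟨ cong (swap c b) (sym (lookup-transposition c b x)) ⟩
  swap c b (lookup (transposition c b) x)           ≡⟨ cong (swap c b) eq ⟩
  swap c b (lookup (transposition c b) y)           ≡⟨ cong (swap c b) (lookup-transposition c b y) ⟩
  swap c b (swap c b y)                             ≡⟨ swap-involutive c b y ⟩
  y                                                 ∎

removeLast-transposition-last : ∀ (b : Fin k) → removeLast (transposition (fromℕ k) (inject₁ b)) ≡ idₚ k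
removeLast-transposition-last {k} b = Perm-ext λ i → inject₁-injective
  (trans (inject₁-removeLast t (transposition-isPerm (fromℕ k) (inject₁ b)) i) (trans (skip i) (cong inject₁ (sym (lookup-idₚ i)))))
  where
  t = transposition (fromℕ k) (inject₁ b)
  skip : ∀ i → skipLast t (inject₁ i) ≡ inject₁ i
  skip i with inject₁ i ≟F inject₁ b
  ... | yes i≡b = begin
    skipLast t (inject₁ i)   ≡⟨ skipLast-last t (inject₁ i) ti≡L ⟩
    lookup t (fromℕ k)       ≡⟨ trans (lookup-transposition (fromℕ k) (inject₁ b) (fromℕ k)) (swap-≡ˡ (fromℕ k) (inject₁ b) refl) ⟩
    inject₁ b                ≡⟨ sym i≡b ⟩
    inject₁ i                ∎
    where
    ti≡L : lookup t (inject₁ i) ≡ fromℕ k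
    ti≡L = trans (lookup-transposition (fromℕ k) (inject₁ b) (inject₁ i)) (swap-≡ʳ _ _ (inject₁≢last i) i≡b)
  ... | no i≢b = trans (skipLast-other t (inject₁ i) (λ ti≡L → inject₁≢last i (trans (sym ti≡i) ti≡L))) ti≡i
    where
    ti≡i : lookup t (inject₁ i) ≡ inject₁ i
    ti≡i = trans (lookup-transposition (fromℕ k) (inject₁ b) (inject₁ i)) (swap-≢ _ _ (inject₁≢last i) i≢b)

transposition-fixes-last : ∀ (c b : Fin k) → FixesLast (transposition (inject₁ c) (inject₁ b))
transposition-fixes-last {k} c b = trans (lookup-transposition (inject₁ c) (inject₁ b) (fromℕ k))
                                         (swap-≢ _ _ (inject₁≢last c ∘ sym) (inject₁≢last b ∘ sym))

removeLast-transposition-inject₁ : ∀ (c b : Fin k) →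
  removeLast (transposition (inject₁ c) (inject₁ b)) ≡ transposition c b
removeLast-transposition-inject₁ {k} c b = Perm-ext λ i → inject₁-injective (begin
  inject₁ (lookup (removeLast t) i)     ≡⟨ removeLast-restricts t (transposition-isPerm (inject₁ c) (inject₁ b)) (transposition-fixes-last c b) i ⟩
  lookup t (inject₁ i)                  ≡⟨ lookup-transposition (inject₁ c) (inject₁ b) (inject₁ i) ⟩
  swap (inject₁ c) (inject₁ b) (inject₁ i) ≡⟨ swap-inject₁ c b i ⟩
  inject₁ (swap c b i)                  ≡⟨ cong inject₁ (sym (lookup-transposition c b i)) ⟩
  inject₁ (lookup (transposition c b) i) ∎)
  where
  t = transposition (inject₁ c) (inject₁ b)

transposition-comm : ∀ {c b : Fin k} → c ≢ b → transposition c b ≡ transposition b c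
transposition-comm {c = c} {b} c≢b = Perm-ext λ z →
  trans (lookup-transposition c b z) (trans (swap-comm c≢b z) (sym (lookup-transposition b c z)))

ε-transposition-last : ∀ (b : Fin k) → ε (transposition (fromℕ k) (inject₁ b)) ≡ -1ℤ
ε-transposition-last {k} b = begin
  ε t                                 ≡⟨ ε-removeLast t (transposition-isPerm (fromℕ k) (inject₁ b)) ⟩
  ε (removeLast t) * lastSign t       ≡⟨ cong₂ _*_ (cong ε (removeLast-transposition-last b)) (lastSign-moved t tL≢L) ⟩
  ε (idₚ k) * -1ℤ                     ≡⟨ cong (_* -1ℤ) (ε-idₚ k) ⟩
  -1ℤ                                 ∎
  where
  t = transposition (fromℕ k) (inject₁ b)
  tL≢L : lookup t (fromℕ k) ≢ fromℕ k
  tL≢L tL≡L = inject₁≢last b (trans (sym (trans (lookup-transposition (fromℕ k) (inject₁ b) (fromℕ k))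
                                                 (swap-≡ˡ (fromℕ k) (inject₁ b) refl))) tL≡L)

ε-transposition : ∀ k (c b : Fin k) → c ≢ b → ε (transposition c b) ≡ -1ℤ
ε-transposition (suc k) c b c≢b with view c | view b
... | ‵fromℕ      | ‵fromℕ      = ⊥-elim (c≢b refl)
... | ‵fromℕ      | ‵inject₁ b′ = ε-transposition-last b′
... | ‵inject₁ c′ | ‵fromℕ      = trans (cong ε (transposition-comm c≢b)) (ε-transposition-last c′)
... | ‵inject₁ c′ | ‵inject₁ b′ = begin
  ε t                                 ≡⟨ ε-removeLast t (transposition-isPerm (inject₁ c′) (inject₁ b′)) ⟩
  ε (removeLast t) * lastSign t       ≡⟨ cong₂ _*_ (cong ε (removeLast-transposition-inject₁ c′ b′))
                                                   (lastSign-fixed t (transposition-fixes-last c′ b′)) ⟩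
  ε (transposition c′ b′) * 1ℤ        ≡⟨ cong (_* 1ℤ) (ε-transposition k c′ b′ (c≢b ∘ cong inject₁)) ⟩
  -1ℤ                                 ∎
  where
  t = transposition (inject₁ c′) (inject₁ b′)

≢last⇒inject₁ : ∀ {x : Fin (suc k)} → x ≢ fromℕ k → ∃ λ i → inject₁ i ≡ x
≢last⇒inject₁ {x = x} x≢L with view x
... | ‵fromℕ     = ⊥-elim (x≢L refl)
... | ‵inject₁ i = i , refl

module _ (σ τ : Perm (suc k)) (σ-inj : IsPerm σ) (τ-inj : IsPerm τ) where
  private
    L = fromℕ k
    στ = σ ∘ₚ τ
    στ-inj : IsPerm στ
    στ-inj = ∘ₚ-isPerm σ τ σ-inj τ-inj
    στL≡ : lookup στ L ≡ lookup σ (lookup τ L)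
    στL≡ = lookup-∘ₚ σ τ L

  skipLast-∘ₚ : FixesLast τ ⊎ FixesLast σ ⊎ FixesLast στ →
                ∀ {x} → x ≢ L → skipLast στ x ≡ skipLast σ (skipLast τ x)
  skipLast-∘ₚ untangled {x} x≢L = go (lookup τ x ≟F L) (lookup σ L ≟F L) (lookup σ (lookup τ x) ≟F L)
    where
    go : Dec (lookup τ x ≡ L) → Dec (lookup σ L ≡ L) → Dec (lookup σ (lookup τ x) ≡ L) →
         skipLast στ x ≡ skipLast σ (skipLast τ x)
    go (yes τx≡L) (yes σL≡L) _ = begin
      skipLast στ x             ≡⟨ skipLast-last στ x (trans (lookup-∘ₚ σ τ x) (trans (cong (lookup σ) τx≡L) σL≡L)) ⟩
      lookup στ L               ≡⟨ στL≡ ⟩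
      lookup σ (lookup τ L)     ≡⟨ sym (skipLast-other σ (lookup τ L) στL≢L) ⟩
      skipLast σ (lookup τ L)   ≡⟨ cong (skipLast σ) (sym (skipLast-last τ x τx≡L)) ⟩
      skipLast σ (skipLast τ x) ∎
      where
      στL≢L : lookup σ (lookup τ L) ≢ L
      στL≢L στL≡L = x≢L (τ-inj (trans τx≡L (sym (σ-inj (trans στL≡L (sym σL≡L))))))
    go (yes τx≡L) (no σL≢L) _ = begin
      skipLast στ x             ≡⟨ skipLast-other στ x (σL≢L ∘ trans (sym στx≡σL)) ⟩
      lookup στ x               ≡⟨ στx≡σL ⟩
      lookup σ L                ≡⟨ sym (skipLast-last σ (lookup τ L) στL≡L) ⟩
      skipLast σ (lookup τ L)   ≡⟨ cong (skipLast σ) (sym (skipLast-last τ x τx≡L)) ⟩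
      skipLast σ (skipLast τ x) ∎
      where
      στx≡σL : lookup στ x ≡ lookup σ L
      στx≡σL = trans (lookup-∘ₚ σ τ x) (cong (lookup σ) τx≡L)
      στL≡L : lookup σ (lookup τ L) ≡ L
      στL≡L = [ (λ τL≡L → ⊥-elim (x≢L (τ-inj (trans τx≡L (sym τL≡L)))))
              , [ (λ σL≡L → ⊥-elim (σL≢L σL≡L)) , trans (sym στL≡) ] ] untangled
    go (no τx≢L) _ (no στx≢L) = begin
      skipLast στ x             ≡⟨ skipLast-other στ x (στx≢L ∘ trans (sym (lookup-∘ₚ σ τ x))) ⟩
      lookup στ x               ≡⟨ lookup-∘ₚ σ τ x ⟩
      lookup σ (lookup τ x)     ≡⟨ sym (skipLast-other σ (lookup τ x) στx≢L) ⟩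
      skipLast σ (lookup τ x)   ≡⟨ cong (skipLast σ) (sym (skipLast-other τ x τx≢L)) ⟩
      skipLast σ (skipLast τ x) ∎
    go (no τx≢L) _ (yes στx≡L) = begin
      skipLast στ x             ≡⟨ skipLast-last στ x (trans (lookup-∘ₚ σ τ x) στx≡L) ⟩
      lookup στ L               ≡⟨ στL≡ ⟩
      lookup σ (lookup τ L)     ≡⟨ cong (lookup σ) τL≡L ⟩
      lookup σ L                ≡⟨ sym (skipLast-last σ (lookup τ x) στx≡L) ⟩
      skipLast σ (lookup τ x)   ≡⟨ cong (skipLast σ) (sym (skipLast-other τ x τx≢L)) ⟩
      skipLast σ (skipLast τ x) ∎
      where
      τL≡L : lookup τ L ≡ L
      τL≡L = [ id , [ (λ σL≡L → ⊥-elim (τx≢L (σ-inj (trans στx≡L (sym σL≡L)))))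
                    , (λ στL≡L → ⊥-elim (x≢L (τ-inj (σ-inj (trans στx≡L (sym (trans (sym στL≡) στL≡L))))))) ] ] untangled

  -- If σ, τ and σ ∘ₚ τ all move the last point, cutting it out of σ ∘ₚ τ differs from cutting it
  -- out of τ and then σ by the transposition of c = τ⁻¹ (σ⁻¹ L) and b = τ⁻¹ L.
  skipLast-∘ₚ-tangled : ∀ {a b c} → lookup σ a ≡ L → lookup τ b ≡ L → lookup τ c ≡ a → a ≢ L → c ≢ L →
                        ∀ {x} → x ≢ L → skipLast στ x ≡ skipLast σ (skipLast τ (swap c b x))
  skipLast-∘ₚ-tangled {a} {b} {c} σa≡L τb≡L τc≡a a≢L c≢L {x} x≢L = go (x ≟F c) (x ≟F b)
    where
    go : Dec (x ≡ c) → Dec (x ≡ b) → skipLast στ x ≡ skipLast σ (skipLast τ (swap c b x))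
    go (yes x≡c) _ = begin
      skipLast στ x                        ≡⟨ skipLast-last στ x στx≡L ⟩
      lookup στ L                          ≡⟨ στL≡ ⟩
      lookup σ (lookup τ L)                ≡⟨ sym (skipLast-other σ (lookup τ L) στL≢L) ⟩
      skipLast σ (lookup τ L)              ≡⟨ cong (skipLast σ) (sym (skipLast-last τ b τb≡L)) ⟩
      skipLast σ (skipLast τ b)            ≡⟨ cong (skipLast σ ∘ skipLast τ) (sym (swap-≡ˡ c b x≡c)) ⟩
      skipLast σ (skipLast τ (swap c b x)) ∎
      where
      στx≡L : lookup στ x ≡ L
      στx≡L = trans (lookup-∘ₚ σ τ x) (trans (cong (lookup σ) (trans (cong (lookup τ) x≡c) τc≡a)) σa≡L)
      στL≢L : lookup σ (lookup τ L) ≢ L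
      στL≢L στL≡L = c≢L (τ-inj (trans τc≡a (sym (σ-inj (trans στL≡L (sym σa≡L))))))
    go (no x≢c) (yes x≡b) = begin
      skipLast στ x                        ≡⟨ skipLast-other στ x (σL≢L ∘ trans (sym στx≡σL)) ⟩
      lookup στ x                          ≡⟨ στx≡σL ⟩
      lookup σ L                           ≡⟨ sym (skipLast-last σ a σa≡L) ⟩
      skipLast σ a                         ≡⟨ cong (skipLast σ) (sym (trans (skipLast-other τ c (a≢L ∘ trans (sym τc≡a))) τc≡a)) ⟩
      skipLast σ (skipLast τ c)            ≡⟨ cong (skipLast σ ∘ skipLast τ) (sym (swap-≡ʳ c b x≢c x≡b)) ⟩
      skipLast σ (skipLast τ (swap c b x)) ∎
      where
      στx≡σL : lookup στ x ≡ lookup σ L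
      στx≡σL = trans (lookup-∘ₚ σ τ x) (cong (lookup σ) (trans (cong (lookup τ) x≡b) τb≡L))
      σL≢L : lookup σ L ≢ L
      σL≢L σL≡L = a≢L (σ-inj (trans σa≡L (sym σL≡L)))
    go (no x≢c) (no x≢b) = begin
      skipLast στ x                        ≡⟨ skipLast-other στ x (στx≢L ∘ trans (sym (lookup-∘ₚ σ τ x))) ⟩
      lookup στ x                          ≡⟨ lookup-∘ₚ σ τ x ⟩
      lookup σ (lookup τ x)                ≡⟨ sym (skipLast-other σ (lookup τ x) στx≢L) ⟩
      skipLast σ (lookup τ x)              ≡⟨ cong (skipLast σ) (sym (skipLast-other τ x τx≢L)) ⟩
      skipLast σ (skipLast τ x)            ≡⟨ cong (skipLast σ ∘ skipLast τ) (sym (swap-≢ c b x≢c x≢b)) ⟩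
      skipLast σ (skipLast τ (swap c b x)) ∎
      where
      τx≢L : lookup τ x ≢ L
      τx≢L τx≡L = x≢b (τ-inj (trans τx≡L (sym τb≡L)))
      στx≢L : lookup σ (lookup τ x) ≢ L
      στx≢L στx≡L = x≢c (τ-inj (trans (σ-inj (trans στx≡L (sym σa≡L))) (sym τc≡a)))

  inject₁-removeLast-∘ₚ : ∀ i → inject₁ (lookup (removeLast σ ∘ₚ removeLast τ) i) ≡ skipLast σ (skipLast τ (inject₁ i))
  inject₁-removeLast-∘ₚ i = begin
    inject₁ (lookup (removeLast σ ∘ₚ removeLast τ) i)         ≡⟨ cong inject₁ (lookup-∘ₚ (removeLast σ) (removeLast τ) i) ⟩
    inject₁ (lookup (removeLast σ) (lookup (removeLast τ) i)) ≡⟨ inject₁-removeLast σ σ-inj _ ⟩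
    skipLast σ (inject₁ (lookup (removeLast τ) i))            ≡⟨ cong (skipLast σ) (inject₁-removeLast τ τ-inj i) ⟩
    skipLast σ (skipLast τ (inject₁ i))                       ∎

  removeLast-∘ₚ : FixesLast τ ⊎ FixesLast σ ⊎ FixesLast στ → removeLast στ ≡ removeLast σ ∘ₚ removeLast τ
  removeLast-∘ₚ untangled = Perm-ext λ i → inject₁-injective (begin
    inject₁ (lookup (removeLast στ) i)                ≡⟨ inject₁-removeLast στ στ-inj i ⟩
    skipLast στ (inject₁ i)                           ≡⟨ skipLast-∘ₚ untangled (inject₁≢last i) ⟩
    skipLast σ (skipLast τ (inject₁ i))               ≡⟨ sym (inject₁-removeLast-∘ₚ i) ⟩
    inject₁ (lookup (removeLast σ ∘ₚ removeLast τ) i) ∎)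

  removeLast-∘ₚ-tangled : ∀ {a} c b → lookup σ a ≡ L → lookup τ (inject₁ b) ≡ L → lookup τ (inject₁ c) ≡ a → a ≢ L →
                          removeLast στ ≡ (removeLast σ ∘ₚ removeLast τ) ∘ₚ transposition c b
  removeLast-∘ₚ-tangled c b σa≡L τb≡L τc≡a a≢L = Perm-ext λ i → inject₁-injective (begin
    inject₁ (lookup (removeLast στ) i)                                ≡⟨ inject₁-removeLast στ στ-inj i ⟩
    skipLast στ (inject₁ i)                                           ≡⟨ skipLast-∘ₚ-tangled σa≡L τb≡L τc≡a a≢L (inject₁≢last c) (inject₁≢last i) ⟩
    skipLast σ (skipLast τ (swap (inject₁ c) (inject₁ b) (inject₁ i))) ≡⟨ cong (skipLast σ ∘ skipLast τ) (swap-inject₁ c b i) ⟩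
    skipLast σ (skipLast τ (inject₁ (swap c b i)))                    ≡⟨ sym (inject₁-removeLast-∘ₚ (swap c b i)) ⟩
    inject₁ (lookup (removeLast σ ∘ₚ removeLast τ) (swap c b i))      ≡⟨ cong inject₁ (sym (lookup-∘ₚ-transposition i)) ⟩
    inject₁ (lookup ((removeLast σ ∘ₚ removeLast τ) ∘ₚ transposition c b) i) ∎)
    where
    lookup-∘ₚ-transposition : ∀ i → lookup ((removeLast σ ∘ₚ removeLast τ) ∘ₚ transposition c b) i
                                    ≡ lookup (removeLast σ ∘ₚ removeLast τ) (swap c b i)
    lookup-∘ₚ-transposition i = trans (lookup-∘ₚ (removeLast σ ∘ₚ removeLast τ) (transposition c b) i)
                                      (cong (lookup (removeLast σ ∘ₚ removeLast τ)) (lookup-transposition c b i))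

  lastSign-∘ₚ : FixesLast τ ⊎ FixesLast σ ⊎ FixesLast στ → lastSign στ ≡ lastSign σ * lastSign τ
  lastSign-∘ₚ (inj₁ τL≡L) = begin
    lastSign στ               ≡⟨ cong (λ y → if ⌊ y ≟F L ⌋ then 1ℤ else -1ℤ) (trans στL≡ (cong (lookup σ) τL≡L)) ⟩
    lastSign σ                ≡⟨ sym (*-identityʳ (lastSign σ)) ⟩
    lastSign σ * 1ℤ           ≡⟨ cong (_*_ (lastSign σ)) (sym (lastSign-fixed τ τL≡L)) ⟩
    lastSign σ * lastSign τ   ∎
  lastSign-∘ₚ (inj₂ σ-or-στ) = go (lookup τ L ≟F L) (lookup σ L ≟F L) σ-or-στ
    where
    go : Dec (FixesLast τ) → Dec (FixesLast σ) → FixesLast σ ⊎ FixesLast στ → lastSign στ ≡ lastSign σ * lastSign τ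
    go (yes τL≡L) _          _            = lastSign-∘ₚ (inj₁ τL≡L)
    go (no τL≢L)  (yes σL≡L) _            =
      trans (lastSign-moved στ (λ στL≡L → τL≢L (σ-inj (trans (trans (sym στL≡) στL≡L) (sym σL≡L)))))
            (sym (cong₂ _*_ (lastSign-fixed σ σL≡L) (lastSign-moved τ τL≢L)))
    go (no _)     (no σL≢L)  (inj₁ σL≡L)  = ⊥-elim (σL≢L σL≡L)
    go (no τL≢L)  (no σL≢L)  (inj₂ στL≡L) =
      trans (lastSign-fixed στ στL≡L) (sym (cong₂ _*_ (lastSign-moved σ σL≢L) (lastSign-moved τ τL≢L)))

Multiplicative : ℕ → Set
Multiplicative k = ∀ (σ τ : Perm k) → IsPerm σ → IsPerm τ → ε (σ ∘ₚ τ) ≡ ε σ * ε τ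

module _ (multiplicative : Multiplicative k) (σ τ : Perm (suc k)) (σ-inj : IsPerm σ) (τ-inj : IsPerm τ) where
  private
    L = fromℕ k
    στ = σ ∘ₚ τ
    ρσ = removeLast σ
    ρτ = removeLast τ
    ρσ-inj : IsPerm ρσ
    ρσ-inj = removeLast-isPerm σ σ-inj
    ρτ-inj : IsPerm ρτ
    ρτ-inj = removeLast-isPerm τ τ-inj

  ε-∘ₚ-untangled : FixesLast τ ⊎ FixesLast σ ⊎ FixesLast στ → ε στ ≡ ε σ * ε τ
  ε-∘ₚ-untangled untangled = begin
    ε στ                                      ≡⟨ ε-removeLast στ (∘ₚ-isPerm σ τ σ-inj τ-inj) ⟩
    ε (removeLast στ) * lastSign στ           ≡⟨ cong₂ _*_ (trans (cong ε (removeLast-∘ₚ σ τ σ-inj τ-inj untangled))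
                                                                  (multiplicative ρσ ρτ ρσ-inj ρτ-inj))
                                                           (lastSign-∘ₚ σ τ σ-inj τ-inj untangled) ⟩
    ε ρσ * ε ρτ * (lastSign σ * lastSign τ)   ≡⟨ interchange (ε ρσ) (ε ρτ) (lastSign σ) (lastSign τ) ⟩
    ε ρσ * lastSign σ * (ε ρτ * lastSign τ)   ≡⟨ sym (cong₂ _*_ (ε-removeLast σ σ-inj) (ε-removeLast τ τ-inj)) ⟩
    ε σ * ε τ                                 ∎
    where
    interchange : ∀ p q r s → p * q * (r * s) ≡ p * r * (q * s)
    interchange = solve-∀

  ε-∘ₚ-tangled : ¬ FixesLast τ → ¬ FixesLast σ → ¬ FixesLast στ → ε στ ≡ ε σ * ε τ
  ε-∘ₚ-tangled τL≢L σL≢L στL≢L = begin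
    ε στ
      ≡⟨ ε-removeLast στ (∘ₚ-isPerm σ τ σ-inj τ-inj) ⟩
    ε (removeLast στ) * lastSign στ
      ≡⟨ cong₂ _*_ (cong ε (removeLast-∘ₚ-tangled σ τ σ-inj τ-inj c′ b′ σa≡L τb′≡L τc′≡a a≢L)) (lastSign-moved στ στL≢L) ⟩
    ε ((ρσ ∘ₚ ρτ) ∘ₚ t) * -1ℤ
      ≡⟨ cong (_* -1ℤ) (multiplicative (ρσ ∘ₚ ρτ) t (∘ₚ-isPerm ρσ ρτ ρσ-inj ρτ-inj) (transposition-isPerm c′ b′)) ⟩
    ε (ρσ ∘ₚ ρτ) * ε t * -1ℤ
      ≡⟨ cong (λ e → e * ε t * -1ℤ) (multiplicative ρσ ρτ ρσ-inj ρτ-inj) ⟩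
    ε ρσ * ε ρτ * ε t * -1ℤ
      ≡⟨ cong (λ e → ε ρσ * ε ρτ * e * -1ℤ) (ε-transposition k c′ b′ c′≢b′) ⟩
    ε ρσ * ε ρτ * -1ℤ * -1ℤ
      ≡⟨ regroup (ε ρσ) (ε ρτ) ⟩
    ε ρσ * -1ℤ * (ε ρτ * -1ℤ)
      ≡⟨ sym (cong₂ _*_ (trans (ε-removeLast σ σ-inj) (cong (_*_ (ε ρσ)) (lastSign-moved σ σL≢L)))
                        (trans (ε-removeLast τ τ-inj) (cong (_*_ (ε ρτ)) (lastSign-moved τ τL≢L)))) ⟩
    ε σ * ε τ ∎
    where
    a = lookup (σ ⁻¹) L
    b = lookup (τ ⁻¹) L
    c = lookup (τ ⁻¹) a
    σa≡L = lookup-⁻¹ʳ σ σ-inj L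
    τb≡L = lookup-⁻¹ʳ τ τ-inj L
    τc≡a = lookup-⁻¹ʳ τ τ-inj a
    a≢L : a ≢ L
    a≢L a≡L = σL≢L (trans (cong (lookup σ) (sym a≡L)) σa≡L)
    b≢L : b ≢ L
    b≢L b≡L = τL≢L (trans (cong (lookup τ) (sym b≡L)) τb≡L)
    c≢L : c ≢ L
    c≢L c≡L = στL≢L (trans (lookup-∘ₚ σ τ L) (trans (cong (lookup σ) (trans (cong (lookup τ) (sym c≡L)) τc≡a)) σa≡L))
    b′ = proj₁ (≢last⇒inject₁ b≢L)
    c′ = proj₁ (≢last⇒inject₁ c≢L)
    τb′≡L : lookup τ (inject₁ b′) ≡ L
    τb′≡L = trans (cong (lookup τ) (proj₂ (≢last⇒inject₁ b≢L))) τb≡L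
    τc′≡a : lookup τ (inject₁ c′) ≡ a
    τc′≡a = trans (cong (lookup τ) (proj₂ (≢last⇒inject₁ c≢L))) τc≡a
    t = transposition c′ b′
    c′≢b′ : c′ ≢ b′
    c′≢b′ c′≡b′ = a≢L (trans (sym τc′≡a) (trans (cong (lookup τ ∘ inject₁) c′≡b′) τb′≡L))
    regroup : ∀ p q → p * q * -1ℤ * -1ℤ ≡ p * -1ℤ * (q * -1ℤ)
    regroup = solve-∀

ε-∘ₚ : ∀ k → Multiplicative k
ε-∘ₚ zero    []    []    _     _     = refl
ε-∘ₚ (suc k) σ τ σ-inj τ-inj
  with lookup τ (fromℕ k) ≟F fromℕ k | lookup σ (fromℕ k) ≟F fromℕ k | lookup (σ ∘ₚ τ) (fromℕ k) ≟F fromℕ k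
... | yes τL≡L | _        | _         = ε-∘ₚ-untangled (ε-∘ₚ k) σ τ σ-inj τ-inj (inj₁ τL≡L)
... | no _     | yes σL≡L | _         = ε-∘ₚ-untangled (ε-∘ₚ k) σ τ σ-inj τ-inj (inj₂ (inj₁ σL≡L))
... | no _     | no _     | yes στL≡L = ε-∘ₚ-untangled (ε-∘ₚ k) σ τ σ-inj τ-inj (inj₂ (inj₂ στL≡L))
... | no τL≢L  | no σL≢L  | no στL≢L  = ε-∘ₚ-tangled (ε-∘ₚ k) σ τ σ-inj τ-inj τL≢L σL≢L στL≢L

-- The long cycle

toℕ-iter-fullCycle : ∀ n j (i : Fin (suc n)) → toℕ (iter (fullCycle (suc n)) j i) ≡ (toℕ i ℕ.+ j) % suc n
toℕ-iter-fullCycle n zero    i = sym (trans (cong (_% suc n) (ℕ.+-identityʳ (toℕ i))) (m<n⇒m%n≡m (toℕ<n i)))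
toℕ-iter-fullCycle n (suc j) i = begin
  toℕ (lookup w (iter w j i))       ≡⟨ cong toℕ (lookup∘tabulate (λ x → suc (toℕ x) mod N) (iter w j i)) ⟩
  toℕ (suc (toℕ (iter w j i)) mod N) ≡⟨ toℕ-fromℕ< (m%n<n (suc (toℕ (iter w j i))) N) ⟩
  suc (toℕ (iter w j i)) % N         ≡⟨ cong (λ m → suc m % N) (toℕ-iter-fullCycle n j i) ⟩
  suc ((toℕ i ℕ.+ j) % N) % N        ≡⟨ %-distribˡ-+ 1 ((toℕ i ℕ.+ j) % N) N ⟩
  (1 % N ℕ.+ (toℕ i ℕ.+ j) % N % N) % N ≡⟨ cong (λ m → (1 % N ℕ.+ m) % N) (m%n%n≡m%n (toℕ i ℕ.+ j) N) ⟩
  (1 % N ℕ.+ (toℕ i ℕ.+ j) % N) % N  ≡⟨ sym (%-distribˡ-+ 1 (toℕ i ℕ.+ j) N) ⟩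
  suc (toℕ i ℕ.+ j) % N              ≡⟨ cong (_% N) (sym (ℕ.+-suc (toℕ i) j)) ⟩
  (toℕ i ℕ.+ suc j) % N              ∎
  where
  N = suc n
  w = fullCycle N

fullCycle-isPerm : ∀ k → IsPerm (fullCycle k)
fullCycle-isPerm zero {()}
fullCycle-isPerm (suc n) {i} {j} eq = begin
  i                        ≡⟨ sym (iter-fullCycle-period i) ⟩
  iter w (suc n) i         ≡⟨ iter-sucʳ w n i ⟩
  iter w n (lookup w i)    ≡⟨ cong (iter w n) eq ⟩
  iter w n (lookup w j)    ≡⟨ sym (iter-sucʳ w n j) ⟩
  iter w (suc n) j         ≡⟨ iter-fullCycle-period j ⟩
  j                        ∎
  where
  w = fullCycle (suc n)
  iter-fullCycle-period : ∀ i → iter w (suc n) i ≡ i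
  iter-fullCycle-period i = toℕ-injective (begin
    toℕ (iter w (suc n) i)      ≡⟨ toℕ-iter-fullCycle n (suc n) i ⟩
    (toℕ i ℕ.+ suc n) % suc n   ≡⟨ [m+n]%n≡m%n (toℕ i) (suc n) ⟩
    toℕ i % suc n               ≡⟨ m<n⇒m%n≡m (toℕ<n i) ⟩
    toℕ i                       ∎)

κ-fullCycle : ∀ n → κ (fullCycle (suc n)) ≡ 1
κ-fullCycle n with isCycleMin (fullCycle (suc n)) Fin.zero | ⇒isCycleMin (fullCycle (suc n)) {Fin.zero} (λ _ → ℕ.z≤n)
... | true | _ = cong suc (cong length (filter-none (T? ∘ isCycleMin w) (All.tabulate notMin)))
  where
  N = suc n
  w = fullCycle N
  -- Following the cycle from suc i for N ∸ suc (toℕ i) steps wraps around to 0.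
  notMin : ∀ {x} → x ∈ List.tabulate Fin.suc → ¬ T (isCycleMin w x)
  notMin x∈ min with i , refl ← ∈-tabulate⁻ x∈ =
    ℕ.<⇒≱ ℕ.z<s (subst (toℕ (Fin.suc i) ≤_) wraps (isCycleMin⇒ w (fullCycle-isPerm N) min m))
    where
    m = N ∸ toℕ (Fin.suc i)
    wraps : toℕ (iter w m (Fin.suc i)) ≡ 0
    wraps = begin
      toℕ (iter w m (Fin.suc i))         ≡⟨ toℕ-iter-fullCycle n m (Fin.suc i) ⟩
      (toℕ (Fin.suc i) ℕ.+ m) % N         ≡⟨ cong (_% N) (m+[n∸m]≡n (<⇒≤ (toℕ<n (Fin.suc i)))) ⟩
      N % N                               ≡⟨ n%n≡0 N ⟩
      0                                   ∎

-- Evaluating Ch_k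

sgn-κ-∘ₚ : ∀ k (σ τ : Perm k) → IsPerm σ → IsPerm τ → sgn (κ σ) * sgn (κ τ) ≡ sgn (k ℕ.+ κ (σ ∘ₚ τ))
sgn-κ-∘ₚ k σ τ σ-inj τ-inj = sym (begin
  sgn (k ℕ.+ κ (σ ∘ₚ τ))                       ≡⟨ ε-∘ₚ k σ τ σ-inj τ-inj ⟩
  sgn (k ℕ.+ κ σ) * sgn (k ℕ.+ κ τ)            ≡⟨ cong₂ _*_ (sgn-+ k (κ σ)) (sgn-+ k (κ τ)) ⟩
  sgn k * sgn (κ σ) * (sgn k * sgn (κ τ))      ≡⟨ interchange (sgn k) (sgn (κ σ)) (sgn k) (sgn (κ τ)) ⟩
  sgn k * sgn k * (sgn (κ σ) * sgn (κ τ))      ≡⟨ cong (_* (sgn (κ σ) * sgn (κ τ))) (sgn-square k) ⟩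
  1ℤ * (sgn (κ σ) * sgn (κ τ))                 ≡⟨ *-identityˡ _ ⟩
  sgn (κ σ) * sgn (κ τ)                        ∎)
  where
  interchange : ∀ p q r s → p * q * (r * s) ≡ p * r * (q * s)
  interchange = solve-∀

[-x]^n*sgn[n]≡x^n : ∀ (x : ℤ) n → (- x) ^ n * sgn n ≡ x ^ n
[-x]^n*sgn[n]≡x^n x zero    = refl
[-x]^n*sgn[n]≡x^n x (suc n) = trans (regroup x ((- x) ^ n) (sgn n)) (cong (_*_ x) ([-x]^n*sgn[n]≡x^n x n))
  where
  regroup : ∀ x a s → (- x * a) * (-1ℤ * s) ≡ x * (a * s)
  regroup = solve-∀

factorises : ∀ k → Perm k → Perm k → Bool
factorises k σ₁ σ₂ = ⌊ ≡-dec _≟F_ (σ₁ ∘ₚ σ₂) (fullCycle k) ⌋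

∑-factorisations-fixedˡ : ∀ k (σ₁ : Perm k) → IsPerm σ₁ → (f : Perm k → ℤ) →
  ∑[ σ₂ ∈ perms k ] (if factorises k σ₁ σ₂ then f σ₂ else 0ℤ) ≡ f (σ₁ ⁻¹ ∘ₚ fullCycle k)
∑-factorisations-fixedˡ k σ₁ σ₁-inj f = ∑-if-unique (factorises k σ₁) f (perms-unique k)
  (∈-perms⁺ (∘ₚ-isPerm (σ₁ ⁻¹) w (⁻¹-isPerm σ₁ σ₁-inj) (fullCycle-isPerm k)))
  (fromWitness (⁻¹-solvesˡ σ₁ σ₁-inj w))
  (λ _ σ₁σ₂≡w → ∘ₚ-cancelˡ σ₁ σ₁-inj (trans (toWitness σ₁σ₂≡w) (sym (⁻¹-solvesˡ σ₁ σ₁-inj w))))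
  where
  w = fullCycle k

∑-factorisations-fixedʳ : ∀ k (σ₂ : Perm k) → IsPerm σ₂ → (f : Perm k → ℤ) →
  ∑[ σ₁ ∈ perms k ] (if factorises k σ₁ σ₂ then f σ₁ else 0ℤ) ≡ f (fullCycle k ∘ₚ σ₂ ⁻¹)
∑-factorisations-fixedʳ k σ₂ σ₂-inj f = ∑-if-unique (λ σ₁ → factorises k σ₁ σ₂) f (perms-unique k)
  (∈-perms⁺ (∘ₚ-isPerm w (σ₂ ⁻¹) (fullCycle-isPerm k) (⁻¹-isPerm σ₂ σ₂-inj)))
  (fromWitness (⁻¹-solvesʳ σ₂ σ₂-inj w))
  (λ _ σ₁σ₂≡w → ∘ₚ-cancelʳ σ₂ σ₂-inj (trans (toWitness σ₁σ₂≡w) (sym (⁻¹-solvesʳ σ₂ σ₂-inj w))))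
  where
  w = fullCycle k

Ch-as-∑ : ∀ k p q → Ch k p q ≡ sgn k * (∑[ σ₁ ∈ perms k ] ∑[ σ₂ ∈ perms k ]
                                       (if factorises k σ₁ σ₂ then (- q) ^ κ σ₁ * p ^ κ σ₂ else 0ℤ))
Ch-as-∑ k p q = cong (_*_ (sgn k)) (sumℤ-concatMap _ (perms k))

Ch-p×[-1] : ∀ k p → Ch k p (- + 1) ≡ (- + 1) ^ k * rising p k
Ch-p×[-1] k p = begin
  Ch k p -1ℤ
    ≡⟨ Ch-as-∑ k p -1ℤ ⟩
  sgn k * (∑[ σ₁ ∈ perms k ] ∑[ σ₂ ∈ perms k ] (if factorises k σ₁ σ₂ then f σ₁ σ₂ else 0ℤ))
    ≡⟨ cong (_*_ (sgn k)) (∑-comm (perms k) (perms k) _) ⟩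
  sgn k * (∑[ σ₂ ∈ perms k ] ∑[ σ₁ ∈ perms k ] (if factorises k σ₁ σ₂ then f σ₁ σ₂ else 0ℤ))
    ≡⟨ cong (_*_ (sgn k)) (∑-cong (perms k) collapse) ⟩
  sgn k * (∑[ σ₂ ∈ perms k ] p ^ κ σ₂)
    ≡⟨ cong (_*_ (sgn k)) (∑-κ-rising k p) ⟩
  sgn k * rising p k ∎
  where
  f : Perm k → Perm k → ℤ
  f σ₁ σ₂ = 1ℤ ^ κ σ₁ * p ^ κ σ₂
  collapse : ∀ {σ₂} → σ₂ ∈ perms k →
             ∑[ σ₁ ∈ perms k ] (if factorises k σ₁ σ₂ then f σ₁ σ₂ else 0ℤ) ≡ p ^ κ σ₂
  collapse {σ₂} σ₂∈ = trans (∑-factorisations-fixedʳ k σ₂ (∈-perms⁻ σ₂∈) (λ σ₁ → f σ₁ σ₂))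
                            (trans (cong (_* p ^ κ σ₂) (^-zeroˡ (κ (fullCycle k ∘ₚ σ₂ ⁻¹)))) (*-identityˡ _))

sgn-κ-cofactor : ∀ n {σ₁ σ₂ : Perm (suc n)} → IsPerm σ₁ → IsPerm σ₂ → σ₁ ∘ₚ σ₂ ≡ fullCycle (suc n) →
                 sgn (κ σ₂) ≡ sgn (κ σ₁) * sgn (suc (suc n))
sgn-κ-cofactor n {σ₁} {σ₂} σ₁-inj σ₂-inj σ₁σ₂≡w = begin
  sgn (κ σ₂)                                   ≡⟨ sym (*-identityˡ _) ⟩
  1ℤ * sgn (κ σ₂)                              ≡⟨ cong (_* sgn (κ σ₂)) (sym (sgn-square (κ σ₁))) ⟩
  sgn (κ σ₁) * sgn (κ σ₁) * sgn (κ σ₂)         ≡⟨ *-assoc (sgn (κ σ₁)) _ _ ⟩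
  sgn (κ σ₁) * (sgn (κ σ₁) * sgn (κ σ₂))       ≡⟨ cong (_*_ (sgn (κ σ₁))) (sgn-κ-∘ₚ (suc n) σ₁ σ₂ σ₁-inj σ₂-inj) ⟩
  sgn (κ σ₁) * sgn (suc n ℕ.+ κ (σ₁ ∘ₚ σ₂))    ≡⟨ cong (λ σ → sgn (κ σ₁) * sgn (suc n ℕ.+ κ σ)) σ₁σ₂≡w ⟩
  sgn (κ σ₁) * sgn (suc n ℕ.+ κ (fullCycle (suc n))) ≡⟨ cong (λ m → sgn (κ σ₁) * sgn (suc n ℕ.+ m)) (κ-fullCycle n) ⟩
  sgn (κ σ₁) * sgn (suc n ℕ.+ 1)               ≡⟨ cong (λ m → sgn (κ σ₁) * sgn m) (ℕ.+-comm (suc n) 1) ⟩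
  sgn (κ σ₁) * sgn (suc (suc n))               ∎

Ch-[-1]×q : ∀ k → 1 ≤ k → ∀ q → Ch k (- + 1) q ≡ - rising q k
Ch-[-1]×q k@(suc n) _ q = begin
  Ch k -1ℤ q
    ≡⟨ Ch-as-∑ k -1ℤ q ⟩
  sgn k * (∑[ σ₁ ∈ perms k ] ∑[ σ₂ ∈ perms k ] (if factorises k σ₁ σ₂ then f σ₁ σ₂ else 0ℤ))
    ≡⟨ cong (_*_ (sgn k)) (∑-cong (perms k) collapse) ⟩
  sgn k * (∑[ σ₁ ∈ perms k ] sgn (suc k) * q ^ κ σ₁)
    ≡⟨ cong (_*_ (sgn k)) (∑-*ˡ (perms k) (sgn (suc k)) _) ⟩
  sgn k * (sgn (suc k) * (∑[ σ₁ ∈ perms k ] q ^ κ σ₁))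
    ≡⟨ cong (λ r → sgn k * (sgn (suc k) * r)) (∑-κ-rising k q) ⟩
  sgn k * (sgn (suc k) * rising q k)
    ≡⟨ sgn-cancel (sgn k) (rising q k) ⟩
  - (sgn k * sgn k * rising q k)
    ≡⟨ cong (λ s → - (s * rising q k)) (sgn-square k) ⟩
  - (1ℤ * rising q k)
    ≡⟨ cong -_ (*-identityˡ _) ⟩
  - rising q k ∎
  where
  f : Perm k → Perm k → ℤ
  f σ₁ σ₂ = (- q) ^ κ σ₁ * sgn (κ σ₂)
  sgn-cancel : ∀ s r → s * (-1ℤ * s * r) ≡ - (s * s * r)
  sgn-cancel = solve-∀
  collapse : ∀ {σ₁} → σ₁ ∈ perms k →
             ∑[ σ₂ ∈ perms k ] (if factorises k σ₁ σ₂ then f σ₁ σ₂ else 0ℤ) ≡ sgn (suc k) * q ^ κ σ₁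
  collapse {σ₁} σ₁∈ = begin
    ∑[ σ₂ ∈ perms k ] (if factorises k σ₁ σ₂ then f σ₁ σ₂ else 0ℤ)
      ≡⟨ ∑-factorisations-fixedˡ k σ₁ σ₁-inj (f σ₁) ⟩
    (- q) ^ κ σ₁ * sgn (κ σ₂)
      ≡⟨ cong (_*_ ((- q) ^ κ σ₁)) (sgn-κ-cofactor n σ₁-inj σ₂-inj (⁻¹-solvesˡ σ₁ σ₁-inj w)) ⟩
    (- q) ^ κ σ₁ * (sgn (κ σ₁) * sgn (suc k))
      ≡⟨ sym (*-assoc ((- q) ^ κ σ₁) _ _) ⟩
    (- q) ^ κ σ₁ * sgn (κ σ₁) * sgn (suc k)
      ≡⟨ cong (_* sgn (suc k)) ([-x]^n*sgn[n]≡x^n q (κ σ₁)) ⟩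
    q ^ κ σ₁ * sgn (suc k)
      ≡⟨ *-comm (q ^ κ σ₁) (sgn (suc k)) ⟩
    sgn (suc k) * q ^ κ σ₁ ∎
    where
    w = fullCycle k
    σ₁-inj = ∈-perms⁻ σ₁∈
    σ₂ = σ₁ ⁻¹ ∘ₚ w
    σ₂-inj = ∘ₚ-isPerm (σ₁ ⁻¹) w (⁻¹-isPerm σ₁ σ₁-inj) (fullCycle-isPerm k)

corollary2p2 : (k : ℕ) → 1 ≤ k →
    ((q : ℤ) → Ch k (- + 1) q ≡ - rising q k) ×
    ((p : ℤ) → Ch k p (- + 1) ≡ ((- + 1) ^ k) * rising p k)
corollary2p2 k 1≤k = Ch-[-1]×q k 1≤k , Ch-p×[-1] k
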